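{- Let $G$ be a cycle with root $r$ and edge weights $\gamma,\tau$, and let $e_1\in E(G)$ be such that $T_1=G-e_1$ is a cable-trench tree of $G$. Let $H$ be a graph with root $r_H$, edge weights $\gamma,\tau$, and cable-trench tree $T_H$. Let $v\neq r$ be a vertex of $G$, and let $G\wedge H$ be obtained by identifying $v$ with $r_H$, rooted at $r$. Let $R_1$ be the $r$–$v$ path in $G$ not containing $e_1$. Suppose that for every edge $e_2$ on $R_1$, with $R_2$ the $r$–$v$ path in $G$ not containing $e_2$ and $T_2=G-e_2$, $$0\geq \tau(e_2)-\tau(e_1)+L(P_2)-L(P_1)+\big(L(P_2)-L(P_1)\big)|\tilde Q|+C(\tilde Q^+)-C(\tilde Q^-)+\big(L(R_1)-L(R_2)\big)|H|.$$ Then $T_1\wedge T_H$ is a cable-trench tree of $G\wedge H$.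
   Context: For a connected rooted graph (root $r$) with edge weights $\gamma,\tau:E\to\mathbb{R}$, the cost of a spanning tree $T$ is $\mathrm{cost}(T)=\sum_{e\in E(T)}\tau(e)+\sum_{w}\sum_{e\in P_T(r,w)}\gamma(e)$, where $P_T(r,w)$ is the unique $r$–$w$ path in $T$; a cable-trench tree is a spanning tree of minimum cost. $T_1\wedge T_H$ denotes the spanning tree of $G\wedge H$ with edge set $E(T_1)\cup E(T_H)$. For a path $P$ with edges $(f_1,\dots,f_k)$ in order of traversal, $|P|=k$, $L(P)=\sum_i\gamma(f_i)$, $C(P)=\sum_{i=1}^k\sum_{j=1}^i\gamma(f_j)$. Given distinct $e_1,e_2$: deleting them from the cycle leaves two paths; $\tilde Q$ is the one not containing $r$. $P_1$ is the path from $r$ along the cycle, in the direction meeting $e_1$ before $e_2$, up to and including $e_1$; $P_2$ is defined symmetrically. $\tilde Q^+$ is $\tilde Q$ traversed from its endpoint incident to $e_2$ to its endpoint incident to $e_1$; $\tilde Q^-$ is the reverse. Paths $R_1,R_2$ are oriented from $r$. $|H|=|V(H)|-1$, the number of vertices of $H$ other than its root. -}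

module Defs where

open import Level using (0ℓ)
open import Data.Nat as ℕ using (ℕ; zero; suc; _∸_)
open import Data.Fin as Fin using (Fin; zero; suc; toℕ; splitAt; _↑ˡ_; _↑ʳ_; punchOut; _≟_)
open import Data.Fin.Subset using (Subset; ∣_∣)
open import Data.Vec using (lookup)
open import Data.Bool using (Bool; true; false; if_then_else_)
open import Data.List as List using (List; []; _∷_; _++_; [_]; inits)
open import Data.List.Relation.Unary.All using (All)
open import Data.List.Relation.Unary.Unique.Propositional using (Unique)
open import Data.Product using (Σ; _×_; _,_; proj₁; proj₂; ∃)
open import Data.Sum using (_⊎_; inj₁; inj₂; [_,_]′)
open import Data.Nat.DivMod using (_mod_)
open import Relation.Nullary using (yes; no)
open import Relation.Binary.PropositionalEquality using (_≡_; _≢_)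
open import Relation.Binary.Structures using (IsTotalOrder)
open import Algebra.Bundles using (CommutativeRing)

record OrderedCommRing : Set₁ where
  field
    commRing : CommutativeRing 0ℓ 0ℓ
  open CommutativeRing commRing public using (Carrier; _≈_; _+_; _*_; -_; _-_; 0#; 1#)
  field
    _≤_        : Carrier → Carrier → Set
    isTotalOrder : IsTotalOrder _≈_ _≤_
    +-monoˡ-≤  : ∀ {x y} z → x ≤ y → (x + z) ≤ (y + z)
    *-nonneg   : ∀ {x y} → 0# ≤ x → 0# ≤ y → 0# ≤ (x * y)

  infix 4 _≥_
  infixr 7 _·_

  _≥_ : Carrier → Carrier → Set
  x ≥ y = y ≤ x

  _·_ : ℕ → Carrier → Carrier
  zero  · x = 0#
  suc n · x = x + (n · x)

  sumL : List Carrier → Carrier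
  sumL = List.foldr _+_ 0#

  sumFin : ∀ {n} → (Fin n → Carrier) → Carrier
  sumFin {zero}  f = 0#
  sumFin {suc n} f = f zero + sumFin (λ i → f (suc i))

record Graph (n : ℕ) : Set where
  field
    nE   : ℕ
    ends : Fin nE → Fin n × Fin n
open Graph public

module _ {n : ℕ} (G : Graph n) where

  Joins : Fin (nE G) → Fin n → Fin n → Set
  Joins e u v = (ends G e ≡ (u , v)) ⊎ (ends G e ≡ (v , u))

  data Walk : Fin n → Fin n → Set where
    nil  : ∀ {u} → Walk u u
    cons : ∀ {u v w} (e : Fin (nE G)) → Joins e u v → Walk v w → Walk u w

  edges : ∀ {u w} → Walk u w → List (Fin (nE G))
  edges nil          = []
  edges (cons e _ p) = e ∷ edges p

  verts : ∀ {u w} → Walk u w → List (Fin n)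
  verts {u} nil          = u ∷ []
  verts {u} (cons e _ p) = u ∷ verts p

  Path : Fin n → Fin n → Set
  Path u w = Σ (Walk u w) (λ p → Unique (verts p))

  pedges : ∀ {u w} → Path u w → List (Fin (nE G))
  pedges p = edges (proj₁ p)

  EndsWith : ∀ {u w} → Fin (nE G) → Path u w → Set
  EndsWith e p = ∃ λ es → pedges p ≡ es ++ [ e ]

  TreePath : Fin n → Subset (nE G) → Fin n → Set
  TreePath r T w = Σ (Path r w) (λ p → All (λ e → lookup T e ≡ true) (pedges p))

  IsSpanningTree : Fin n → Subset (nE G) → Set
  IsSpanningTree r T = (∀ w → TreePath r T w) × (∣ T ∣ ≡ n ∸ 1)

  module _ (R : OrderedCommRing) where
    open OrderedCommRing R

    L : (Fin (nE G) → Carrier) → List (Fin (nE G)) → Carrier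
    L γ es = sumL (List.map γ es)

    -- C(P) = Σ_i Σ_{j ≤ i} γ(f_j) = sum of L over all prefixes
    C : (Fin (nE G) → Carrier) → List (Fin (nE G)) → Carrier
    C γ es = sumL (List.map (L γ) (inits es))

    cost : (γ τ : Fin (nE G) → Carrier) (r : Fin n) (T : Subset (nE G)) →
           (∀ w → TreePath r T w) → Carrier
    cost γ τ r T ps =
      sumFin (λ e → if lookup T e then τ e else 0#)
      + sumFin (λ w → L γ (pedges (proj₁ (ps w))))

    -- T is a cable-trench tree (minimum-cost spanning tree).
    -- (Tree paths are unique, so quantifying over path choices is harmless.)
    IsCableTrench : (γ τ : Fin (nE G) → Carrier) (r : Fin n) → Subset (nE G) → Set
    IsCableTrench γ τ r T =
      IsSpanningTree r T ×
      (∀ T' → IsSpanningTree r T' →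
        ∀ (ps : ∀ w → TreePath r T w) (ps' : ∀ w → TreePath r T' w) →
        cost γ τ r T ps ≤ cost γ τ r T' ps')

Cycle : (k : ℕ) .{{_ : ℕ.NonZero k}} → Graph k
Cycle k = record { nE = k ; ends = λ i → (i , (suc (toℕ i) mod k)) }

-- Wedge G ∧ H: identify v ∈ V(G) with the root rH of H.
-- Vertices: Fin (k + m), G's vertices first, then H's non-root vertices.
-- Edges: G's edges first, then H's edges.

hmap : ∀ {k m} → Fin k → Fin (suc m) → Fin (suc m) → Fin (k ℕ.+ m)
hmap {k} {m} v rH x with rH ≟ x
... | yes _   = v ↑ˡ m
... | no rH≢x = k ↑ʳ punchOut rH≢x

wedge : ∀ {k m} → Graph k → Fin k → Graph (suc m) → Fin (suc m) → Graph (k ℕ.+ m)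
wedge {k} {m} G v H rH = record
  { nE   = nE G ℕ.+ nE H
  ; ends = λ e → [ (λ e' → let (a , b) = ends G e' in (a ↑ˡ m , b ↑ˡ m))
                 , (λ e' → let (a , b) = ends H e' in (hmap v rH a , hmap v rH b)) ]′
                 (splitAt (nE G) e)
  }

joinW : ∀ {A : Set} {a b} → (Fin a → A) → (Fin b → A) → Fin (a ℕ.+ b) → A
joinW {a = a} f g e = [ f , g ]′ (splitAt a e)

-- A spanning tree of G ∧ H has (k − 1) + m edges and restricts to connected spanning subgraphs of
-- the cycle G and of H; since these need at least k − 1 and m edges, they are spanning trees
-- T_G = G − e₂ and T_H, and every vertex of H is reached through v. So the cost of the tree is
-- cost(T_G) + m · L(r–v path of T_G) + cost(T_H), and the last summand is minimised by T_H.
-- If e₂ is not on R₁, the r–v paths of G − e₁ and G − e₂ agree and the optimality of G − e₁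
-- concludes. Otherwise going from G − e₁ to G − e₂ only changes the distances to the vertices of Q,
-- which switch from P₁ to P₂, and the change of the first two summands is exactly the quantity that
-- the hypothesis bounds by 0.

module Submission where

open import Defs

open import Algebra.Bundles using (CommutativeRing)
import Algebra.Properties.CommutativeSemigroup as CommSemigroupProperties
import Algebra.Properties.Ring as RingProperties
open import Data.Bool as Bool using (true; false; if_then_else_)
open import Data.Empty using (⊥-elim)
open import Data.Fin as Fin using (Fin; zero; suc; toℕ; _↑ˡ_; _↑ʳ_; punchIn)
import Data.Fin.Properties as Finₚ
open import Data.Fin.Subset using (Subset; ∣_∣; ∁; ⁅_⁆)
open import Data.Fin.Subset.Properties using (∣p∣≡n⇒p≡⊤; x∈⁅x⁆; x≢y⇒x∉⁅y⁆; x∈p⇒x∉∁p; x∉p⇒x∈∁p)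
open import Data.List as List using (List; []; _∷_; [_]; map; length; reverse; inits; tabulate)
import Data.List.Properties as Listₚ
import Data.List.Membership.DecPropositional as DecMembership
open import Data.List.Membership.Propositional using (_∈_; _∉_)
open import Data.List.Membership.Propositional.Properties using (∈-allFin; ∈-map⁺; ∈-map⁻; ∈-++⁺ˡ; ∈-++⁺ʳ)
open import Data.List.Membership.Propositional.Properties.WithK using (unique∧set⇒bag)
open import Data.List.Relation.Binary.BagAndSetEquality using (∼bag⇒↭)
open import Data.List.Relation.Binary.Permutation.Propositional using (_↭_; ↭⇒↭ₛ′)
import Data.List.Relation.Binary.Permutation.Propositional.Properties as ↭
import Data.List.Relation.Binary.Permutation.Setoid.Properties as ↭ₛ
open import Data.List.Relation.Unary.All as All using (All; []; _∷_)
import Data.List.Relation.Unary.All.Properties as Allₚ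
open import Data.List.Relation.Unary.AllPairs using ([]; _∷_)
open import Data.List.Relation.Unary.Any as Any using (here; there; _─_)
import Data.List.Relation.Unary.Any.Properties as Anyₚ
open import Data.List.Relation.Unary.Unique.Propositional using (Unique)
import Data.List.Relation.Unary.Unique.Propositional.Properties as Uniqueₚ
open import Data.Maybe using (nothing)
open import Data.Nat as ℕ using (ℕ; zero; suc; NonZero)
open import Data.Nat.DivMod using (_mod_; _%_; %-distribˡ-+; m%n%n≡m%n; [m+n]%n≡m%n; m<n⇒m%n≡m; m%n<n)
import Data.Nat.Properties as ℕₚ
open import Data.Product using (Σ; ∃; ∃₂; _×_; _,_; proj₁; proj₂)
open import Data.Product.Properties using (×-≡,≡←≡)
open import Data.Sum using (_⊎_; inj₁; inj₂; [_,_]′)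
open import Data.Vec as Vec using ([]; _∷_; lookup)
import Data.Vec.Properties as Vecₚ
open Vecₚ using ([]=⇒lookup; lookup⇒[]=)
open import Function using (case_of_)
open import Function.Bundles using (mk⇔)
open import Relation.Binary.PropositionalEquality as ≡ using (_≡_; _≢_)
import Relation.Binary.Reasoning.Setoid as SetoidReasoning
open import Relation.Binary.Structures using (IsTotalOrder)
open import Relation.Nullary using (¬_; Dec; yes; no)
open import Relation.Nullary.Decidable using (decidable-stable; ¬¬-excluded-middle)
open import Tactic.RingSolver.Core.AlmostCommutativeRing using (fromCommutativeRing)
import Tactic.RingSolver.NonReflective as RingSolver

-- List concatenation is only opened locally: proposition2 is stated with Vec's _++_.
module _ where

  open import Data.List using (_++_)
  open import Data.Nat using (_+_; _<_; _≤_; z≤n; s≤s)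

  Unique-++⁻ : ∀ {A : Set} (xs ys : List A) → Unique (xs ++ ys) →
               Unique xs × Unique ys × (∀ {z} → z ∈ xs → z ∉ ys)
  Unique-++⁻ []       ys ys!            = [] , ys! , λ ()
  Unique-++⁻ (x ∷ xs) ys (x∉xs++ys ∷ u) with Unique-++⁻ xs ys u
  ... | xs! , ys! , disjoint =
    All.tabulate (λ z∈xs → All.lookup x∉xs++ys (∈-++⁺ˡ z∈xs)) ∷ xs! , ys! , disjoint′
    where
    disjoint′ : ∀ {z} → z ∈ x ∷ xs → z ∉ ys
    disjoint′ (here ≡.refl) z∈ys = All.lookup x∉xs++ys (∈-++⁺ʳ xs z∈ys) ≡.refl
    disjoint′ (there z∈xs)  z∈ys = disjoint z∈xs z∈ys

  Unique-map⁺-onAll : ∀ {A B : Set} (f : A → B) {P : A → Set} →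
                      (∀ {x y} → P x → P y → f x ≡ f y → x ≡ y) →
                      ∀ {xs} → All P xs → Unique xs → Unique (map f xs)
  Unique-map⁺-onAll f inj []         []            = []
  Unique-map⁺-onAll f inj (px ∷ pxs) (x∉xs ∷ xs!) = All.tabulate fx∉ ∷ Unique-map⁺-onAll f inj pxs xs!
    where
    fx∉ : ∀ {z} → z ∈ map f _ → f _ ≢ z
    fx∉ z∈ ≡.refl with ∈-map⁻ f z∈
    ... | y , y∈xs , fx≡fy = All.lookup x∉xs y∈xs (inj px (All.lookup pxs y∈xs) fx≡fy)

  ∈-─ : ∀ {A : Set} {x z : A} (xs : List A) (x∈ : x ∈ xs) → z ∈ xs → z ≢ x → z ∈ (xs ─ x∈)
  ∈-─ (_ ∷ xs) (here ≡.refl) (here ≡.refl) z≢x = ⊥-elim (z≢x ≡.refl)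
  ∈-─ (_ ∷ xs) (here ≡.refl) (there z∈)    z≢x = z∈
  ∈-─ (y ∷ xs) (there x∈)    (here ≡.refl) z≢x = here ≡.refl
  ∈-─ (y ∷ xs) (there x∈)    (there z∈)    z≢x = there (∈-─ xs x∈ z∈ z≢x)

  Unique⇒length≤ : ∀ {A : Set} (ys xs : List A) → Unique ys → (∀ {y} → y ∈ ys → y ∈ xs) → length ys ≤ length xs
  Unique⇒length≤ []       xs _             _   = z≤n
  Unique⇒length≤ (y ∷ ys) xs (y∉ys ∷ ys!) ys⊆ =
    ≡.subst (length (y ∷ ys) ≤_) (≡.sym (Listₚ.length-removeAt′ xs (Any.index y∈xs)))
      (s≤s (Unique⇒length≤ ys (xs ─ y∈xs) ys! λ z∈ys →
         ∈-─ xs y∈xs (ys⊆ (there z∈ys)) (λ z≡y → All.lookup y∉ys z∈ys (≡.sym z≡y))))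
    where
    y∈xs : y ∈ xs
    y∈xs = ys⊆ (here ≡.refl)

  range : ℕ → ℕ → List ℕ
  range i zero    = []
  range i (suc n) = i ∷ range (suc i) n

  length-range : ∀ i n → length (range i n) ≡ n
  length-range i zero    = ≡.refl
  length-range i (suc n) = ≡.cong suc (length-range (suc i) n)

  range-++ : ∀ i a b → range i (a + b) ≡ range i a ++ range (i + a) b
  range-++ i zero    b = ≡.cong (λ j → range j b) (≡.sym (ℕₚ.+-identityʳ i))
  range-++ i (suc a) b =
    ≡.cong (i ∷_) (≡.trans (range-++ (suc i) a b) (≡.cong (λ j → range (suc i) a ++ range j b) (≡.sym (ℕₚ.+-suc i a))))

  range-∷ʳ : ∀ i n → range i (suc n) ≡ range i n ++ [ i + n ]
  range-∷ʳ i n = ≡.trans (≡.cong (range i) (ℕₚ.+-comm 1 n)) (range-++ i n 1)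

  range-+ : ∀ a i n → range (a + i) n ≡ map (a +_) (range i n)
  range-+ a i zero    = ≡.refl
  range-+ a i (suc n) =
    ≡.cong ((a + i) ∷_) (≡.trans (≡.cong (λ j → range j n) (≡.sym (ℕₚ.+-suc a i))) (range-+ a (suc i) n))

  map-range-suc : ∀ {A : Set} (f : ℕ → A) a n → map f (range (suc a) n) ≡ map (λ t → f (suc t)) (range a n)
  map-range-suc f a zero    = ≡.refl
  map-range-suc f a (suc n) = ≡.cong (f (suc a) ∷_) (map-range-suc f (suc a) n)

  ∈-range⁻ : ∀ {t} i n → t ∈ range i n → i ≤ t × t < i + n
  ∈-range⁻ i (suc n) (here ≡.refl) = ℕₚ.≤-refl , ≡.subst (i <_) (≡.sym (ℕₚ.+-suc i n)) (s≤s (ℕₚ.m≤m+n i n))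
  ∈-range⁻ {t} i (suc n) (there t∈) with ∈-range⁻ (suc i) n t∈
  ... | i<t , t<1+i+n = ℕₚ.<⇒≤ i<t , ≡.subst (t <_) (≡.sym (ℕₚ.+-suc i n)) t<1+i+n

  ∈-range⁺ : ∀ {t} i n → i ≤ t → t < i + n → t ∈ range i n
  ∈-range⁺ {t} i zero    i≤t t<i+0 =
    ⊥-elim (ℕₚ.<-irrefl ≡.refl (ℕₚ.≤-<-trans i≤t (≡.subst (t <_) (ℕₚ.+-identityʳ i) t<i+0)))
  ∈-range⁺ {t} i (suc n) i≤t t<i+n with ℕₚ.m≤n⇒m<n∨m≡n i≤t
  ... | inj₂ ≡.refl = here ≡.refl
  ... | inj₁ i<t    = there (∈-range⁺ (suc i) n i<t (≡.subst (t <_) (ℕₚ.+-suc i n) t<i+n))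

  Unique-range : ∀ i n → Unique (range i n)
  Unique-range i zero    = []
  Unique-range i (suc n) =
    All.tabulate (λ t∈ i≡t → ℕₚ.<-irrefl i≡t (proj₁ (∈-range⁻ (suc i) n t∈))) ∷ Unique-range (suc i) n

  ≤-+-tight : ∀ {a b x y} → x ≤ a → y ≤ b → a + b ≡ x + y → a ≡ x × b ≡ y
  ≤-+-tight {a} {b} {x} {y} x≤a y≤b a+b≡x+y =
    ℕₚ.≤-antisym (ℕₚ.+-cancelʳ-≤ y a x (ℕₚ.≤-trans (ℕₚ.+-monoʳ-≤ a y≤b) (ℕₚ.≤-reflexive a+b≡x+y))) x≤a ,
    ℕₚ.≤-antisym (ℕₚ.+-cancelˡ-≤ x b y (ℕₚ.≤-trans (ℕₚ.+-monoˡ-≤ b x≤a) (ℕₚ.≤-reflexive a+b≡x+y))) y≤b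

AllBut : ∀ {n} → Subset n → Fin n → Set
AllBut T e = lookup T e ≡ false × (∀ e′ → e′ ≢ e → lookup T e′ ≡ true)

∁⁅e⁆-AllBut : ∀ {n} (e : Fin n) → AllBut (∁ ⁅ e ⁆) e
∁⁅e⁆-AllBut e = lookup-excluded , λ e′ e′≢e → []=⇒lookup (x∉p⇒x∈∁p (x≢y⇒x∉⁅y⁆ e′≢e))
  where
  lookup-excluded : lookup (∁ ⁅ e ⁆) e ≡ false
  lookup-excluded with lookup (∁ ⁅ e ⁆) e in eq
  ... | true  = ⊥-elim (x∈p⇒x∉∁p (x∈⁅x⁆ e) (lookup⇒[]= e _ eq))
  ... | false = ≡.refl

missing-edge : ∀ {n} .{{_ : NonZero n}} (T : Subset n) → ∣ T ∣ ≡ n ℕ.∸ 1 → ∃ (AllBut T)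
missing-edge {suc n} (false ∷ T) ∣T∣≡n = zero , ≡.refl , others
  where
  others : ∀ e′ → e′ ≢ zero → lookup (false ∷ T) e′ ≡ true
  others zero     e′≢0 = ⊥-elim (e′≢0 ≡.refl)
  others (suc e′) _    = ≡.trans (≡.cong (λ p → lookup p e′) (∣p∣≡n⇒p≡⊤ {p = T} ∣T∣≡n)) (Vecₚ.lookup-replicate e′ true)
missing-edge {suc (suc n)} (true ∷ T) ∣T∣≡n with missing-edge T (ℕₚ.suc-injective ∣T∣≡n)
... | e , Te , others = suc e , Te , others′
  where
  others′ : ∀ e′ → e′ ≢ suc e → lookup (true ∷ T) e′ ≡ true
  others′ zero     _     = ≡.refl
  others′ (suc e′) e′≢e = others e′ (λ e′≡e → e′≢e (≡.cong suc e′≡e))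

false∉All : ∀ {n} (T : Subset n) {x es} → All (λ e → lookup T e ≡ true) es → lookup T x ≡ false → x ∉ es
false∉All T Tes Tx x∈es = case ≡.trans (≡.sym (All.lookup Tes x∈es)) Tx of λ ()

∣++∣ : ∀ {a b} (A : Subset a) (B : Subset b) → ∣ A Vec.++ B ∣ ≡ ∣ A ∣ ℕ.+ ∣ B ∣
∣++∣ []          B = ≡.refl
∣++∣ (true  ∷ A) B = ≡.cong suc (∣++∣ A B)
∣++∣ (false ∷ A) B = ∣++∣ A B

members : ∀ {m} → Subset m → List (Fin m)
members {zero}  []          = []
members {suc m} (true  ∷ p) = zero ∷ map suc (members p)
members {suc m} (false ∷ p) = map suc (members p)

length-members : ∀ {m} (p : Subset m) → length (members p) ≡ ∣ p ∣
length-members {zero}  []          = ≡.refl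
length-members {suc m} (true  ∷ p) = ≡.cong suc (≡.trans (Listₚ.length-map suc (members p)) (length-members p))
length-members {suc m} (false ∷ p) = ≡.trans (Listₚ.length-map suc (members p)) (length-members p)

∈-members : ∀ {m} (p : Subset m) {e} → lookup p e ≡ true → e ∈ members p
∈-members (true  ∷ p) {zero}  _  = here ≡.refl
∈-members (true  ∷ p) {suc e} pe = there (∈-map⁺ suc (∈-members p pe))
∈-members (false ∷ p) {suc e} pe = ∈-map⁺ suc (∈-members p pe)

module OrderedCommRingProperties (S : OrderedCommRing) where

  open import Data.List using (_++_)

  open OrderedCommRing S public
  open CommutativeRing commRing public
    using (setoid; isEquivalence; reflexive; +-cong; +-congˡ; +-congʳ; +-comm; +-assoc;
           +-identityˡ; +-identityʳ; -‿inverseʳ; +-isCommutativeMonoid)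
    renaming (refl to ≈-refl; sym to ≈-sym; trans to ≈-trans)
  open CommSemigroupProperties (CommutativeRing.+-commutativeSemigroup commRing) public
    using (interchange; x∙yz≈y∙xz; xy∙z≈xz∙y)
  open RingProperties (CommutativeRing.ring commRing) public
    using (-‿+-comm; -0#≈0#; +-cancelˡ; xyx⁻¹≈y)
  open IsTotalOrder isTotalOrder public
    using (≤-respˡ-≈; ≤-respʳ-≈) renaming (reflexive to ≤-reflexive; trans to ≤-trans)
  module ≈-Reasoning = SetoidReasoning setoid
  module Solver = RingSolver (fromCommutativeRing commRing (λ _ → nothing))

  +-monoʳ-≤ : ∀ {x y} z → x ≤ y → (z + x) ≤ (z + y)
  +-monoʳ-≤ {x} {y} z x≤y = ≤-respˡ-≈ (+-comm x z) (≤-respʳ-≈ (+-comm y z) (+-monoˡ-≤ z x≤y))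

  +-mono-≤ : ∀ {a b c d} → a ≤ b → c ≤ d → (a + c) ≤ (b + d)
  +-mono-≤ {b = b} {c} a≤b c≤d = ≤-trans (+-monoˡ-≤ c a≤b) (+-monoʳ-≤ b c≤d)

  ≤-from-gap : ∀ {a b d} → a ≈ b + d → d ≤ 0# → a ≤ b
  ≤-from-gap {b = b} a≈b+d d≤0 = ≤-respˡ-≈ (≈-sym a≈b+d) (≤-respʳ-≈ (+-identityʳ b) (+-monoʳ-≤ b d≤0))

  ·-congʳ : ∀ n {x y} → x ≈ y → n · x ≈ n · y
  ·-congʳ zero    x≈y = ≈-refl
  ·-congʳ (suc n) x≈y = +-cong x≈y (·-congʳ n x≈y)

  ·-distrib-+ : ∀ n x y → n · (x + y) ≈ n · x + n · y
  ·-distrib-+ zero    x y = ≈-sym (+-identityˡ 0#)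
  ·-distrib-+ (suc n) x y = ≈-trans (+-congˡ (·-distrib-+ n x y)) (interchange x y (n · x) (n · y))

  ·-distrib-- : ∀ n x y → n · (x - y) ≈ n · x - n · y
  ·-distrib-- zero    x y = ≈-sym (≈-trans (+-identityˡ (- 0#)) -0#≈0#)
  ·-distrib-- (suc n) x y = begin
    (x - y) + n · (x - y)       ≈⟨ +-congˡ (·-distrib-- n x y) ⟩
    (x - y) + (n · x - n · y)   ≈⟨ interchange x (- y) (n · x) (- (n · y)) ⟩
    suc n · x + (- y - n · y)   ≈⟨ +-congˡ (-‿+-comm y (n · y)) ⟩
    suc n · x - suc n · y       ∎
    where open ≈-Reasoning

  sumFin-cong : ∀ {n} {f g : Fin n → Carrier} → (∀ i → f i ≈ g i) → sumFin f ≈ sumFin g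
  sumFin-cong {zero}  f≈g = ≈-refl
  sumFin-cong {suc n} f≈g = +-cong (f≈g zero) (sumFin-cong (λ i → f≈g (suc i)))

  sumFin-+ : ∀ {n} (f g : Fin n → Carrier) → sumFin (λ i → f i + g i) ≈ sumFin f + sumFin g
  sumFin-+ {zero}  f g = ≈-sym (+-identityˡ 0#)
  sumFin-+ {suc n} f g =
    ≈-trans (+-congˡ (sumFin-+ (λ i → f (suc i)) (λ i → g (suc i)))) (interchange _ _ _ _)

  sumFin-↑ : ∀ a {b} (f : Fin (a ℕ.+ b) → Carrier) →
             sumFin f ≈ sumFin (λ i → f (i ↑ˡ b)) + sumFin (λ j → f (a ↑ʳ j))
  sumFin-↑ zero    f = ≈-sym (+-identityˡ _)
  sumFin-↑ (suc a) f = ≈-trans (+-congˡ (sumFin-↑ a (λ i → f (suc i)))) (≈-sym (+-assoc _ _ _))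

  sumFin-const : ∀ n x → sumFin {n} (λ _ → x) ≈ n · x
  sumFin-const zero    x = ≈-refl
  sumFin-const (suc n) x = +-congˡ (sumFin-const n x)

  sumFin-punchIn : ∀ {n} (i : Fin (suc n)) (f : Fin (suc n) → Carrier) →
                   sumFin f ≈ f i + sumFin (λ j → f (punchIn i j))
  sumFin-punchIn zero f = ≈-refl
  sumFin-punchIn {suc n} (suc i) f =
    ≈-trans (+-congˡ (sumFin-punchIn i (λ j → f (suc j)))) (x∙yz≈y∙xz _ _ _)

  sumFin-AllBut : ∀ {n} (f : Fin n → Carrier) {T x} → AllBut T x →
                  sumFin (λ e → if lookup T e then f e else 0#) ≈ sumFin f - f x
  sumFin-AllBut {suc n} f {T} {x} (Tx , others) = begin
    sumFin f′                                     ≈⟨ sumFin-punchIn x f′ ⟩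
    f′ x + sumFin (λ j → f′ (punchIn x j))        ≈⟨ +-cong (reflexive (≡.cong (λ b → if b then f x else 0#) Tx))
                                                           (sumFin-cong kept) ⟩
    0# + sumFin (λ j → f (punchIn x j))           ≈⟨ +-identityˡ _ ⟩
    sumFin (λ j → f (punchIn x j))                ≈⟨ xyx⁻¹≈y (f x) _ ⟨
    (f x + sumFin (λ j → f (punchIn x j))) - f x  ≈⟨ +-congʳ (sumFin-punchIn x f) ⟨
    sumFin f - f x                                ∎
    where
    open ≈-Reasoning
    f′ : Fin (suc n) → Carrier
    f′ e = if lookup T e then f e else 0#
    kept : ∀ j → f′ (punchIn x j) ≈ f (punchIn x j)
    kept j = reflexive (≡.cong (λ b → if b then f (punchIn x j) else 0#) (others _ (Finₚ.punchInᵢ≢i x j)))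

  sumL-++ : ∀ xs ys → sumL (xs ++ ys) ≈ sumL xs + sumL ys
  sumL-++ []       ys = ≈-sym (+-identityˡ _)
  sumL-++ (x ∷ xs) ys = ≈-trans (+-congˡ (sumL-++ xs ys)) (≈-sym (+-assoc _ _ _))

  sumL-map-++ : ∀ {A : Set} (f : A → Carrier) xs ys →
                sumL (map f (xs ++ ys)) ≈ sumL (map f xs) + sumL (map f ys)
  sumL-map-++ f xs ys = ≈-trans (reflexive (≡.cong sumL (Listₚ.map-++ f xs ys))) (sumL-++ (map f xs) _)

  sumL-reverse : ∀ xs → sumL (reverse xs) ≈ sumL xs
  sumL-reverse []       = ≈-refl
  sumL-reverse (x ∷ xs) = begin
    sumL (reverse (x ∷ xs))        ≡⟨ ≡.cong sumL (Listₚ.unfold-reverse x xs) ⟩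
    sumL (reverse xs ++ [ x ])     ≈⟨ sumL-++ (reverse xs) [ x ] ⟩
    sumL (reverse xs) + (x + 0#)   ≈⟨ +-cong (sumL-reverse xs) (+-identityʳ x) ⟩
    sumL xs + x                    ≈⟨ +-comm _ _ ⟩
    x + sumL xs                    ∎
    where open ≈-Reasoning

  sumL-map-cong : ∀ {A : Set} {f g : A → Carrier} xs → (∀ {t} → t ∈ xs → f t ≈ g t) →
                  sumL (map f xs) ≈ sumL (map g xs)
  sumL-map-cong []       f≈g = ≈-refl
  sumL-map-cong (x ∷ xs) f≈g = +-cong (f≈g (here ≡.refl)) (sumL-map-cong xs (λ t∈ → f≈g (there t∈)))

  sumL-map-+ : ∀ {A : Set} (f g : A → Carrier) xs →
               sumL (map (λ t → f t + g t) xs) ≈ sumL (map f xs) + sumL (map g xs)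
  sumL-map-+ f g []       = ≈-sym (+-identityˡ _)
  sumL-map-+ f g (x ∷ xs) = ≈-trans (+-congˡ (sumL-map-+ f g xs)) (interchange _ _ _ _)

  sumL-map-const : ∀ {A : Set} x (xs : List A) → sumL (map (λ _ → x) xs) ≈ length xs · x
  sumL-map-const x []       = ≈-refl
  sumL-map-const x (y ∷ xs) = +-congˡ (sumL-map-const x xs)

  sumFin≡sumL-tabulate : ∀ {n} (f : Fin n → Carrier) → sumFin f ≡ sumL (tabulate f)
  sumFin≡sumL-tabulate {zero}  f = ≡.refl
  sumFin≡sumL-tabulate {suc n} f = ≡.cong (f zero +_) (sumFin≡sumL-tabulate (λ i → f (suc i)))

  sumFin-enumeration : ∀ {n} (f : Fin n → Carrier) {xs} → Unique xs → (∀ w → w ∈ xs) →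
                       sumFin f ≈ sumL (map f xs)
  sumFin-enumeration {n} f {xs} xs! complete =
    ≡.subst (_≈ sumL (map f xs))
      (≡.trans (≡.cong sumL (Listₚ.map-tabulate (λ i → i) f)) (≡.sym (sumFin≡sumL-tabulate f)))
      (↭ₛ.foldr-commMonoid setoid +-isCommutativeMonoid (↭⇒↭ₛ′ isEquivalence (↭.map⁺ f allFin↭xs)))
    where
    allFin↭xs : List.allFin n ↭ xs
    allFin↭xs = ∼bag⇒↭ (unique∧set⇒bag (Uniqueₚ.allFin⁺ n) xs! (mk⇔ (λ _ → complete _) (λ _ → ∈-allFin _)))

module PathLengthProperties (S : OrderedCommRing) {nV : ℕ} (G : Graph nV) (γ : Fin (nE G) → OrderedCommRing.Carrier S) where

  open import Data.List using (_++_)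

  open OrderedCommRingProperties S

  ℓ : List (Fin (nE G)) → Carrier
  ℓ = L G S γ

  c : List (Fin (nE G)) → Carrier
  c = C G S γ

  L-++ : ∀ xs ys → ℓ (xs ++ ys) ≈ ℓ xs + ℓ ys
  L-++ = sumL-map-++ γ

  L-reverse : ∀ xs → ℓ (reverse xs) ≈ ℓ xs
  L-reverse xs = ≡.subst (_≈ ℓ xs) (≡.sym (≡.cong sumL (Listₚ.reverse-map γ xs))) (sumL-reverse (map γ xs))

  length-inits : ∀ {A : Set} (xs : List A) → length (inits xs) ≡ suc (length xs)
  length-inits []       = ≡.refl
  length-inits (x ∷ xs) = ≡.cong suc (≡.trans (Listₚ.length-map (x ∷_) (inits xs)) (length-inits xs))

  C-∷ : ∀ x xs → c (x ∷ xs) ≈ suc (length xs) · γ x + c xs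
  C-∷ x xs = begin
    c (x ∷ xs)                                         ≈⟨ +-identityˡ _ ⟩
    sumL (map ℓ (map (x ∷_) (inits xs)))               ≡⟨ ≡.cong sumL (≡.sym (Listₚ.map-∘ (inits xs))) ⟩
    sumL (map (λ ys → γ x + ℓ ys) (inits xs))          ≈⟨ sumL-map-+ (λ _ → γ x) ℓ (inits xs) ⟩
    sumL (map (λ _ → γ x) (inits xs)) + c xs           ≈⟨ +-congʳ (sumL-map-const (γ x) (inits xs)) ⟩
    length (inits xs) · γ x + c xs                     ≡⟨ ≡.cong (λ l → l · γ x + c xs) (length-inits xs) ⟩
    suc (length xs) · γ x + c xs                       ∎
    where open ≈-Reasoning

  C-∷ʳ : ∀ ys x → c (ys ++ [ x ]) ≈ c ys + ℓ (ys ++ [ x ])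
  C-∷ʳ []       x = ≈-trans (+-identityˡ _) (≈-trans (+-identityʳ _) (≈-sym (≈-trans (+-congʳ (+-identityʳ 0#)) (+-identityˡ _))))
  C-∷ʳ (y ∷ ys) x = begin
    c (y ∷ ys ++ [ x ])                                        ≈⟨ C-∷ y (ys ++ [ x ]) ⟩
    suc (length (ys ++ [ x ])) · γ y + c (ys ++ [ x ])         ≡⟨ ≡.cong (λ l → suc l · γ y + c (ys ++ [ x ])) length-ys∷ʳx ⟩
    (γ y + suc (length ys) · γ y) + c (ys ++ [ x ])            ≈⟨ +-congˡ (C-∷ʳ ys x) ⟩
    (γ y + suc (length ys) · γ y) + (c ys + ℓ (ys ++ [ x ]))   ≈⟨ regroup _ _ _ _ ⟩
    (suc (length ys) · γ y + c ys) + (γ y + ℓ (ys ++ [ x ]))   ≈⟨ +-congʳ (≈-sym (C-∷ y ys)) ⟩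
    c (y ∷ ys) + ℓ (y ∷ ys ++ [ x ])                           ∎
    where
    open ≈-Reasoning
    length-ys∷ʳx : length (ys ++ [ x ]) ≡ suc (length ys)
    length-ys∷ʳx = ≡.trans (Listₚ.length-++ ys) (ℕₚ.+-comm (length ys) 1)
    regroup : ∀ a b c d → (a + b) + (c + d) ≈ (b + c) + (a + d)
    regroup = solve 4 (λ a b c d → ((a ⊕ b) ⊕ (c ⊕ d)) ⊜ ((b ⊕ c) ⊕ (a ⊕ d))) ≈-refl
      where open Solver

  C-reverse : ∀ xs → c xs + c (reverse xs) ≈ suc (length xs) · ℓ xs
  C-reverse []       = +-cong (+-identityʳ 0#) (+-identityʳ 0#)
  C-reverse (x ∷ xs) = begin
    c (x ∷ xs) + c (reverse (x ∷ xs))                        ≡⟨ ≡.cong (λ zs → c (x ∷ xs) + c zs) (Listₚ.unfold-reverse x xs) ⟩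
    c (x ∷ xs) + c (reverse xs ++ [ x ])                     ≈⟨ +-cong (C-∷ x xs) (C-∷ʳ (reverse xs) x) ⟩
    (n · γ x + c xs) + (c (reverse xs) + ℓ (reverse xs ++ [ x ]))
                                                             ≈⟨ +-congˡ (+-congˡ (L-++ (reverse xs) [ x ])) ⟩
    (n · γ x + c xs) + (c (reverse xs) + (ℓ (reverse xs) + (γ x + 0#)))
                                                             ≈⟨ +-congˡ (+-congˡ (+-cong (L-reverse xs) (+-identityʳ _))) ⟩
    (n · γ x + c xs) + (c (reverse xs) + (ℓ xs + γ x))       ≈⟨ regroup (n · γ x) (c xs) (c (reverse xs)) (ℓ xs) (γ x) ⟩
    (γ x + n · γ x) + ((c xs + c (reverse xs)) + ℓ xs)       ≈⟨ +-congˡ (+-congʳ (C-reverse xs)) ⟩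
    (γ x + n · γ x) + (n · ℓ xs + ℓ xs)                      ≈⟨ +-congˡ (+-comm _ _) ⟩
    suc n · γ x + suc n · ℓ xs                               ≈⟨ ≈-sym (·-distrib-+ (suc n) (γ x) (ℓ xs)) ⟩
    suc n · (γ x + ℓ xs)                                     ∎
    where
    open ≈-Reasoning
    n : ℕ
    n = suc (length xs)
    regroup : ∀ a b c d e → (a + b) + (c + (d + e)) ≈ (e + a) + ((b + c) + d)
    regroup = solve 5 (λ a b c d e → ((a ⊕ b) ⊕ (c ⊕ (d ⊕ e))) ⊜ ((e ⊕ a) ⊕ ((b ⊕ c) ⊕ d))) ≈-refl
      where open Solver

module WalkProperties {n : ℕ} (G : Graph n) where

  open import Data.List using (_++_)

  infixr 5 _++ʷ_

  _++ʷ_ : ∀ {s t u} → Walk G s t → Walk G t u → Walk G s u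
  nil        ++ʷ q = q
  cons e j p ++ʷ q = cons e j (p ++ʷ q)

  castʷ : ∀ {s s′ t t′} → s ≡ s′ → t ≡ t′ → Walk G s t → Walk G s′ t′
  castʷ ≡.refl ≡.refl p = p

  edges-castʷ : ∀ {s s′ t t′} (s≡ : s ≡ s′) (t≡ : t ≡ t′) p → edges G (castʷ s≡ t≡ p) ≡ edges G p
  edges-castʷ ≡.refl ≡.refl p = ≡.refl

  verts-castʷ : ∀ {s s′ t t′} (s≡ : s ≡ s′) (t≡ : t ≡ t′) p → verts G (castʷ s≡ t≡ p) ≡ verts G p
  verts-castʷ ≡.refl ≡.refl p = ≡.refl

  initVerts : ∀ {s t} → Walk G s t → List (Fin n)
  initVerts nil              = []
  initVerts {s} (cons e j p) = s ∷ initVerts p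

  edges-++ʷ : ∀ {s t u} (p : Walk G s t) (q : Walk G t u) → edges G (p ++ʷ q) ≡ edges G p ++ edges G q
  edges-++ʷ nil          q = ≡.refl
  edges-++ʷ (cons e j p) q = ≡.cong (e ∷_) (edges-++ʷ p q)

  verts-++ʷ : ∀ {s t u} (p : Walk G s t) (q : Walk G t u) → verts G (p ++ʷ q) ≡ initVerts p ++ verts G q
  verts-++ʷ nil          q = ≡.refl
  verts-++ʷ (cons e j p) q = ≡.cong (_ ∷_) (verts-++ʷ p q)

  verts≡initVerts∷ʳ : ∀ {s t} (p : Walk G s t) → verts G p ≡ initVerts p ++ [ t ]
  verts≡initVerts∷ʳ nil          = ≡.refl
  verts≡initVerts∷ʳ (cons e j p) = ≡.cong (_ ∷_) (verts≡initVerts∷ʳ p)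

  head∈verts : ∀ {s t} (p : Walk G s t) → s ∈ verts G p
  head∈verts nil          = here ≡.refl
  head∈verts (cons e j p) = here ≡.refl

  last∈verts : ∀ {s t} (p : Walk G s t) → t ∈ verts G p
  last∈verts nil          = here ≡.refl
  last∈verts (cons e j p) = there (last∈verts p)

  initVerts⊆verts : ∀ {s t} (p : Walk G s t) {z} → z ∈ initVerts p → z ∈ verts G p
  initVerts⊆verts (cons e j p) (here z≡s)  = here z≡s
  initVerts⊆verts (cons e j p) (there z∈) = there (initVerts⊆verts p z∈)

  Unique-initVerts : ∀ {s t} (p : Walk G s t) → Unique (verts G p) → Unique (initVerts p) × t ∉ initVerts p
  Unique-initVerts nil          _            = [] , λ ()
  Unique-initVerts (cons e j p) (s∉p ∷ p!) with Unique-initVerts p p!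
  ... | init! , t∉init = All.tabulate (λ z∈ → All.lookup s∉p (initVerts⊆verts p z∈)) ∷ init! , t∉
    where
    t∉ : _ ∉ initVerts (cons e j p)
    t∉ (here t≡s)  = All.lookup s∉p (last∈verts p) (≡.sym t≡s)
    t∉ (there t∈) = t∉init t∈

module Reachability {n : ℕ} (G : Graph n) where

  data Reach (es : List (Fin (nE G))) : Fin n → Fin n → Set where
    stay : ∀ {x} → Reach es x x
    step : ∀ {x y z} e → e ∈ es → Joins G e x y → Reach es y z → Reach es x z

  Reach-trans : ∀ {es x y z} → Reach es x y → Reach es y z → Reach es x z
  Reach-trans stay            q = q
  Reach-trans (step e e∈ j p) q = step e e∈ j (Reach-trans p q)

  Reach-∷⁻ : ∀ {e es x y} → Reach (e ∷ es) x y →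
             Reach es x y ⊎
             ((Reach es x (proj₁ (ends G e)) ⊎ Reach es x (proj₂ (ends G e))) ×
              (Reach es (proj₁ (ends G e)) y ⊎ Reach es (proj₂ (ends G e)) y))
  Reach-∷⁻ stay = inj₁ stay
  Reach-∷⁻ {e} (step f (there f∈) j p) with Reach-∷⁻ {e} p
  ... | inj₁ q               = inj₁ (step f f∈ j q)
  ... | inj₂ (inj₁ q , rest) = inj₂ (inj₁ (step f f∈ j q) , rest)
  ... | inj₂ (inj₂ q , rest) = inj₂ (inj₂ (step f f∈ j q) , rest)
  Reach-∷⁻ {e} (step .e (here ≡.refl) (inj₁ ends≡) p) with ends G e | ends≡ | Reach-∷⁻ {e} p
  ... | _ | ≡.refl | inj₁ q        = inj₂ (inj₁ stay , inj₂ q)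
  ... | _ | ≡.refl | inj₂ (_ , q)  = inj₂ (inj₁ stay , q)
  Reach-∷⁻ {e} (step .e (here ≡.refl) (inj₂ ends≡) p) with ends G e | ends≡ | Reach-∷⁻ {e} p
  ... | _ | ≡.refl | inj₁ q        = inj₂ (inj₂ stay , inj₁ q)
  ... | _ | ≡.refl | inj₂ (_ , q)  = inj₂ (inj₂ stay , q)

  ReachedFrom : List (Fin (nE G)) → List (Fin n) → Fin n → Set
  ReachedFrom es X y = ∃ λ x → x ∈ X × Reach es x y

  reroute : ∀ {e es X a b} → Joins G e a b → ReachedFrom es X a →
            ∀ {y} → ReachedFrom (e ∷ es) X y → ReachedFrom es (b ∷ X) y
  reroute {e} {es} {X} {a} {b} j (x₀ , x₀∈ , x₀⇝a) (x , x∈ , x⇝y) with Reach-∷⁻ x⇝y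
  ... | inj₁ q = x , there x∈ , q
  ... | inj₂ (_ , suffix) = via j suffix
    where
    via : ∀ {y} → Joins G e a b →
          Reach es (proj₁ (ends G e)) y ⊎ Reach es (proj₂ (ends G e)) y → ReachedFrom es (b ∷ X) y
    via (inj₁ ends≡) q with ends G e | ends≡ | q
    ... | _ | ≡.refl | inj₁ a⇝y = x₀ , there x₀∈ , Reach-trans x₀⇝a a⇝y
    ... | _ | ≡.refl | inj₂ b⇝y = b , here ≡.refl , b⇝y
    via (inj₂ ends≡) q with ends G e | ends≡ | q
    ... | _ | ≡.refl | inj₁ b⇝y = b , here ≡.refl , b⇝y
    ... | _ | ≡.refl | inj₂ a⇝y = x₀ , there x₀∈ , Reach-trans x₀⇝a a⇝y

  by-cases : ∀ {A : Set} {i j} → (Dec A → i ℕ.≤ j) → i ℕ.≤ j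
  by-cases {i = i} {j} k = decidable-stable (i ℕ.≤? j) (λ i≰j → ¬¬-excluded-middle (λ a? → i≰j (k a?)))

  -- Induction on es: if an end of the first edge is reached from X, the other end can be added
  -- to X; otherwise the edge is useless. Reachability is not decided, but the goal is, so we may
  -- split cases on it classically (by-cases).
  reach-count : ∀ es X Y → Unique Y → (∀ {y} → y ∈ Y → ReachedFrom es X y) →
                length Y ℕ.≤ length X ℕ.+ length es
  reach-count [] X Y Y! reached =
    ≡.subst (length Y ℕ.≤_) (≡.sym (ℕₚ.+-identityʳ _)) (Unique⇒length≤ Y X Y! (λ y∈ → origin (reached y∈)))
    where
    origin : ∀ {y} → ReachedFrom [] X y → y ∈ X
    origin (x , x∈ , stay) = x∈
  reach-count (e ∷ es) X Y Y! reached =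
    by-cases {A = ReachedFrom es X a} λ where
      (yes a-reached) → shift (reach-count es (b ∷ X) Y Y! (λ y∈ → reroute (inj₁ ≡.refl) a-reached (reached y∈)))
      (no a-unreached) → by-cases {A = ReachedFrom es X b} λ where
        (yes b-reached) → shift (reach-count es (a ∷ X) Y Y! (λ y∈ → reroute (inj₂ ≡.refl) b-reached (reached y∈)))
        (no b-unreached) → ℕₚ.≤-trans (reach-count es X Y Y! (λ y∈ → unused a-unreached b-unreached (reached y∈)))
                                      (ℕₚ.+-monoʳ-≤ (length X) (ℕₚ.n≤1+n _))
    where
    a b : Fin n
    a = proj₁ (ends G e)
    b = proj₂ (ends G e)
    shift : length Y ℕ.≤ suc (length X) ℕ.+ length es → length Y ℕ.≤ length X ℕ.+ suc (length es)
    shift = ≡.subst (length Y ℕ.≤_) (≡.sym (ℕₚ.+-suc _ _))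
    unused : ¬ ReachedFrom es X a → ¬ ReachedFrom es X b → ∀ {y} → ReachedFrom (e ∷ es) X y → ReachedFrom es X y
    unused ¬a ¬b (x , x∈ , x⇝y) with Reach-∷⁻ x⇝y
    ... | inj₁ q              = x , x∈ , q
    ... | inj₂ (inj₁ q , _)   = ⊥-elim (¬a (x , x∈ , q))
    ... | inj₂ (inj₂ q , _)   = ⊥-elim (¬b (x , x∈ , q))

  Reach-members : ∀ (T : Subset (nE G)) {u w} (p : Walk G u w) → All (λ e → lookup T e ≡ true) (edges G p) →
                  Reach (members T) u w
  Reach-members T nil          []        = stay
  Reach-members T (cons e j p) (Te ∷ Tp) = step e (∈-members T Te) j (Reach-members T p Tp)

spanning⇒∣T∣≥n∸1 : ∀ {n} (G : Graph n) (r : Fin n) (T : Subset (nE G)) → (∀ w → TreePath G r T w) →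
                   n ℕ.∸ 1 ℕ.≤ ∣ T ∣
spanning⇒∣T∣≥n∸1 {zero}  G r T paths = ℕ.z≤n
spanning⇒∣T∣≥n∸1 {suc n} G r T paths =
  ≡.subst (n ℕ.≤_) (length-members T)
    (ℕₚ.≤-pred (≡.subst (ℕ._≤ suc (length (members T))) (Listₚ.length-tabulate (λ i → i))
      (reach-count (members T) [ r ] (List.allFin (suc n)) (Uniqueₚ.allFin⁺ (suc n))
        (λ {w} _ → r , here ≡.refl , Reach-members T (proj₁ (proj₁ (paths w))) (proj₂ (paths w))))))
  where open Reachability G

module WedgeStructure {k m : ℕ} (G : Graph k) (v : Fin k) (H : Graph (suc m)) (rH : Fin (suc m)) where

  open import Data.List using (_++_)

  W : Graph (k ℕ.+ m)
  W = wedge G v H rH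

  ιG : Fin k → Fin (k ℕ.+ m)
  ιG a = a ↑ˡ m

  ιH : Fin (suc m) → Fin (k ℕ.+ m)
  ιH = hmap v rH

  εG : Fin (nE G) → Fin (nE W)
  εG e = e ↑ˡ nE H

  εH : Fin (nE H) → Fin (nE W)
  εH f = nE G ↑ʳ f

  ↑ˡ≢↑ʳ : ∀ (a : Fin k) (j : Fin m) → a ↑ˡ m ≢ k ↑ʳ j
  ↑ˡ≢↑ʳ a j eq =
    case ≡.trans (≡.sym (Finₚ.splitAt-↑ˡ k a m)) (≡.trans (≡.cong (Fin.splitAt k) eq) (Finₚ.splitAt-↑ʳ k m j)) of λ ()

  ιH-root : ιH rH ≡ ιG v
  ιH-root with rH Fin.≟ rH
  ... | yes _   = ≡.refl
  ... | no rH≢rH = ⊥-elim (rH≢rH ≡.refl)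

  ιH-punchIn : ∀ j → ιH (punchIn rH j) ≡ k ↑ʳ j
  ιH-punchIn j with rH Fin.≟ punchIn rH j
  ... | yes rH≡ = ⊥-elim (Finₚ.punchInᵢ≢i rH j (≡.sym rH≡))
  ... | no rH≢  = ≡.cong (k ↑ʳ_) (Finₚ.punchOut-punchIn rH)

  ιH≡ιG⇒root : ∀ {x a} → ιH x ≡ ιG a → x ≡ rH × a ≡ v
  ιH≡ιG⇒root {x} {a} eq with rH Fin.≟ x
  ... | yes ≡.refl = ≡.refl , Finₚ.↑ˡ-injective m a v (≡.sym eq)
  ... | no _       = ⊥-elim (↑ˡ≢↑ʳ a _ (≡.sym eq))

  ιH-injective : ∀ {x y} → ιH x ≡ ιH y → x ≡ y
  ιH-injective {x} {y} eq with rH Fin.≟ x | rH Fin.≟ y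
  ... | yes ≡.refl | yes ≡.refl = ≡.refl
  ... | yes ≡.refl | no _       = ⊥-elim (↑ˡ≢↑ʳ v _ eq)
  ... | no _       | yes ≡.refl = ⊥-elim (↑ˡ≢↑ʳ v _ (≡.sym eq))
  ... | no rH≢x    | no rH≢y    = Finₚ.punchOut-injective rH≢x rH≢y (Finₚ.↑ʳ-injective k _ _ eq)

  -- Splitting on root? x instead of on rH ≟ x keeps the with-abstraction from rewriting the
  -- (with-defined) ιH x occurring in the goal.
  root? : ∀ x → rH ≡ x ⊎ rH ≢ x
  root? x with rH Fin.≟ x
  ... | yes rH≡x = inj₁ rH≡x
  ... | no  rH≢x = inj₂ rH≢x

  ιG-injective : ∀ {a b} → ιG a ≡ ιG b → a ≡ b
  ιG-injective = Finₚ.↑ˡ-injective m _ _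

  data WedgeVertex : Fin (k ℕ.+ m) → Set where
    inG : ∀ a → WedgeVertex (ιG a)
    inH : ∀ j → WedgeVertex (k ↑ʳ j)

  wedgeVertex : ∀ w → WedgeVertex w
  wedgeVertex w with Fin.splitAt k w in eq
  ... | inj₁ a = ≡.subst WedgeVertex (Finₚ.splitAt⁻¹-↑ˡ eq) (inG a)
  ... | inj₂ j = ≡.subst WedgeVertex (Finₚ.splitAt⁻¹-↑ʳ eq) (inH j)

  data WedgeEdge : Fin (nE W) → Set where
    inG : ∀ e → WedgeEdge (εG e)
    inH : ∀ f → WedgeEdge (εH f)

  wedgeEdge : ∀ x → WedgeEdge x
  wedgeEdge x with Fin.splitAt (nE G) x in eq
  ... | inj₁ e = ≡.subst WedgeEdge (Finₚ.splitAt⁻¹-↑ˡ eq) (inG e)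
  ... | inj₂ f = ≡.subst WedgeEdge (Finₚ.splitAt⁻¹-↑ʳ eq) (inH f)

  ends-εG : ∀ e → ends W (εG e) ≡ (ιG (proj₁ (ends G e)) , ιG (proj₂ (ends G e)))
  ends-εG e rewrite Finₚ.splitAt-↑ˡ (nE G) e (nE H) = ≡.refl

  ends-εH : ∀ f → ends W (εH f) ≡ (ιH (proj₁ (ends H f)) , ιH (proj₂ (ends H f)))
  ends-εH f rewrite Finₚ.splitAt-↑ʳ (nE G) (nE H) f = ≡.refl

  Joins-εG⁺ : ∀ {e a b} → Joins G e a b → Joins W (εG e) (ιG a) (ιG b)
  Joins-εG⁺ {e} (inj₁ ≡.refl) = inj₁ (ends-εG e)
  Joins-εG⁺ {e} (inj₂ ≡.refl) = inj₂ (ends-εG e)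

  Joins-εH⁺ : ∀ {f a b} → Joins H f a b → Joins W (εH f) (ιH a) (ιH b)
  Joins-εH⁺ {f} (inj₁ ≡.refl) = inj₁ (ends-εH f)
  Joins-εH⁺ {f} (inj₂ ≡.refl) = inj₂ (ends-εH f)

  Joins-εG⁻ : ∀ {e s u} → Joins W (εG e) s u → ∃₂ λ a b → s ≡ ιG a × u ≡ ιG b × Joins G e a b
  Joins-εG⁻ {e} (inj₁ eq) with ×-≡,≡←≡ (≡.trans (≡.sym (ends-εG e)) eq)
  ... | s≡ , u≡ = _ , _ , ≡.sym s≡ , ≡.sym u≡ , inj₁ ≡.refl
  Joins-εG⁻ {e} (inj₂ eq) with ×-≡,≡←≡ (≡.trans (≡.sym (ends-εG e)) eq)
  ... | u≡ , s≡ = _ , _ , ≡.sym s≡ , ≡.sym u≡ , inj₂ ≡.refl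

  Joins-εH⁻ : ∀ {f s u} → Joins W (εH f) s u → ∃₂ λ x y → s ≡ ιH x × u ≡ ιH y × Joins H f x y
  Joins-εH⁻ {f} (inj₁ eq) with ×-≡,≡←≡ (≡.trans (≡.sym (ends-εH f)) eq)
  ... | s≡ , u≡ = _ , _ , ≡.sym s≡ , ≡.sym u≡ , inj₁ ≡.refl
  Joins-εH⁻ {f} (inj₂ eq) with ×-≡,≡←≡ (≡.trans (≡.sym (ends-εH f)) eq)
  ... | u≡ , s≡ = _ , _ , ≡.sym s≡ , ≡.sym u≡ , inj₂ ≡.refl

  liftG : ∀ {a b} → Walk G a b → Walk W (ιG a) (ιG b)
  liftG nil          = nil
  liftG (cons e j p) = cons (εG e) (Joins-εG⁺ j) (liftG p)

  liftH : ∀ {x y} → Walk H x y → Walk W (ιH x) (ιH y)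
  liftH nil          = nil
  liftH (cons f j p) = cons (εH f) (Joins-εH⁺ j) (liftH p)

  edges-liftG : ∀ {a b} (p : Walk G a b) → edges W (liftG p) ≡ map εG (edges G p)
  edges-liftG nil          = ≡.refl
  edges-liftG (cons e j p) = ≡.cong (_ ∷_) (edges-liftG p)

  verts-liftG : ∀ {a b} (p : Walk G a b) → verts W (liftG p) ≡ map ιG (verts G p)
  verts-liftG nil          = ≡.refl
  verts-liftG (cons e j p) = ≡.cong (_ ∷_) (verts-liftG p)

  initVerts-liftG : ∀ {a b} (p : Walk G a b) →
                    WalkProperties.initVerts W (liftG p) ≡ map ιG (WalkProperties.initVerts G p)
  initVerts-liftG nil          = ≡.refl
  initVerts-liftG (cons e j p) = ≡.cong (_ ∷_) (initVerts-liftG p)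

  edges-liftH : ∀ {x y} (p : Walk H x y) → edges W (liftH p) ≡ map εH (edges H p)
  edges-liftH nil          = ≡.refl
  edges-liftH (cons f j p) = ≡.cong (_ ∷_) (edges-liftH p)

  verts-liftH : ∀ {x y} (p : Walk H x y) → verts W (liftH p) ≡ map ιH (verts H p)
  verts-liftH nil          = ≡.refl
  verts-liftH (cons f j p) = ≡.cong (_ ∷_) (verts-liftH p)

  open WalkProperties W using (head∈verts)

  passes-v-from-G : ∀ {s t} (p : Walk W s t) {a y} → s ≡ ιG a → a ≢ v → t ≡ ιH y → ιG v ∈ verts W p
  passes-v-from-G nil          s≡ a≢v t≡ = ⊥-elim (a≢v (proj₂ (ιH≡ιG⇒root (≡.trans (≡.sym t≡) s≡))))
  passes-v-from-G (cons x J p) s≡ a≢v t≡ with wedgeEdge x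
  passes-v-from-G (cons .(εG e) J p) s≡ a≢v t≡ | inG e with Joins-εG⁻ J
  ... | _ , b , ≡.refl , ≡.refl , _ with b Fin.≟ v
  ...   | yes ≡.refl = there (head∈verts p)
  ...   | no b≢v     = there (passes-v-from-G p ≡.refl b≢v t≡)
  passes-v-from-G (cons .(εH f) J p) s≡ a≢v t≡ | inH f with Joins-εH⁻ J
  ... | _ , _ , ≡.refl , ≡.refl , _ = ⊥-elim (a≢v (proj₂ (ιH≡ιG⇒root s≡)))

  passes-v-from-H : ∀ {s t} (p : Walk W s t) {x b} → s ≡ ιH x → rH ≢ x → t ≡ ιG b → ιG v ∈ verts W p
  passes-v-from-H nil          s≡ rH≢x t≡ = ⊥-elim (rH≢x (≡.sym (proj₁ (ιH≡ιG⇒root (≡.trans (≡.sym s≡) t≡)))))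
  passes-v-from-H (cons z J p) s≡ rH≢x t≡ with wedgeEdge z
  passes-v-from-H (cons .(εG e) J p) s≡ rH≢x t≡ | inG e with Joins-εG⁻ J
  ... | _ , _ , ≡.refl , ≡.refl , _ = ⊥-elim (rH≢x (≡.sym (proj₁ (ιH≡ιG⇒root (≡.sym s≡)))))
  passes-v-from-H (cons .(εH f) J p) s≡ rH≢x t≡ | inH f with Joins-εH⁻ J
  ... | _ , y , ≡.refl , ≡.refl , _ with root? y
  ...   | inj₁ ≡.refl = there (≡.subst (_∈ verts W p) ιH-root (head∈verts p))
  ...   | inj₂ rH≢y  = there (passes-v-from-H p ≡.refl rH≢y t≡)

  -- A path crosses between the two sides only at v, which it visits once; so a path between
  -- vertices of G stays in G, and one between vertices of H stays in H.
  restrictG : ∀ {s t} (p : Walk W s t) {a b} → s ≡ ιG a → t ≡ ιG b → Unique (verts W p) →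
              Σ (Walk G a b) λ q → edges W p ≡ map εG (edges G q) × verts W p ≡ map ιG (verts G q)
  restrictG nil {a} {b} ≡.refl t≡ _ with ιG-injective {a} {b} t≡
  ... | ≡.refl = nil , ≡.refl , ≡.refl
  restrictG (cons z J p) s≡ t≡ u with wedgeEdge z
  restrictG (cons .(εG e) J p) s≡ t≡ (_ ∷ p!) | inG e with Joins-εG⁻ J
  ... | _ , _ , ≡.refl , ≡.refl , j with ιG-injective s≡
  ...   | ≡.refl with restrictG p ≡.refl t≡ p!
  ...     | q , edges≡ , verts≡ = cons e j q , ≡.cong (εG e ∷_) edges≡ , ≡.cong (_ ∷_) verts≡
  restrictG (cons .(εH f) J p) s≡ t≡ (s∉p ∷ _) | inH f with Joins-εH⁻ J
  ... | _ , y , ≡.refl , ≡.refl , _ with ιH≡ιG⇒root s≡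
  ...   | ≡.refl , ≡.refl with root? y
  ...     | inj₁ ≡.refl = ⊥-elim (All.lookup s∉p (head∈verts p) ≡.refl)
  ...     | inj₂ rH≢y  =
    ⊥-elim (All.lookup s∉p (≡.subst (_∈ verts W p) (≡.sym s≡) (passes-v-from-H p ≡.refl rH≢y t≡)) ≡.refl)

  restrictH : ∀ {s t} (p : Walk W s t) {x y} → s ≡ ιH x → t ≡ ιH y → Unique (verts W p) →
              Σ (Walk H x y) λ q → edges W p ≡ map εH (edges H q) × verts W p ≡ map ιH (verts H q)
  restrictH nil ≡.refl t≡ _ with ιH-injective t≡
  ... | ≡.refl = nil , ≡.refl , ≡.refl
  restrictH (cons z J p) s≡ t≡ u with wedgeEdge z
  restrictH (cons .(εG e) J p) s≡ t≡ (s∉p ∷ _) | inG e with Joins-εG⁻ J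
  ... | _ , b , ≡.refl , ≡.refl , _ with ιH≡ιG⇒root (≡.sym s≡)
  ...   | ≡.refl , ≡.refl with b Fin.≟ v
  ...     | yes ≡.refl = ⊥-elim (All.lookup s∉p (head∈verts p) ≡.refl)
  ...     | no b≢v     = ⊥-elim (All.lookup s∉p (passes-v-from-G p ≡.refl b≢v t≡) ≡.refl)
  restrictH (cons .(εH f) J p) s≡ t≡ (_ ∷ p!) | inH f with Joins-εH⁻ J
  ... | _ , _ , ≡.refl , ≡.refl , j with ιH-injective s≡
  ...   | ≡.refl with restrictH p ≡.refl t≡ p!
  ...     | q , edges≡ , verts≡ = cons f j q , ≡.cong (εH f ∷_) edges≡ , ≡.cong (_ ∷_) verts≡

  split-at-v : ∀ {s t} (p : Walk W s t) {a y} → s ≡ ιG a → t ≡ ιH y → rH ≢ y → Unique (verts W p) →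
             Σ (Walk G a v) λ q → Σ (Walk H rH y) λ h →
               edges W p ≡ map εG (edges G q) ++ map εH (edges H h) ×
               verts W p ≡ map ιG (WalkProperties.initVerts G q) ++ map ιH (verts H h)
  split-at-v nil s≡ t≡ rH≢y _ = ⊥-elim (rH≢y (≡.sym (proj₁ (ιH≡ιG⇒root (≡.trans (≡.sym t≡) s≡)))))
  split-at-v (cons z J p) s≡ t≡ rH≢y u with wedgeEdge z
  split-at-v (cons .(εG e) J p) s≡ t≡ rH≢y (_ ∷ p!) | inG e with Joins-εG⁻ J
  ... | _ , _ , ≡.refl , ≡.refl , j with ιG-injective s≡
  ...   | ≡.refl with split-at-v p ≡.refl t≡ rH≢y p!
  ...     | q , h , edges≡ , verts≡ = cons e j q , h , ≡.cong (εG e ∷_) edges≡ , ≡.cong (_ ∷_) verts≡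
  split-at-v (cons .(εH f) J p) s≡ t≡ rH≢y u | inH f with Joins-εH⁻ J
  ... | _ , _ , ≡.refl , ≡.refl , _ with ιH≡ιG⇒root s≡
  ...   | ≡.refl , ≡.refl with restrictH (cons (εH f) J p) ≡.refl t≡ u
  ...     | h , edges≡ , verts≡ = nil , h , edges≡ , verts≡

module WedgeTrees (S : OrderedCommRing) {k m : ℕ} (G : Graph k) (v r : Fin k) (H : Graph (suc m)) (rH : Fin (suc m))
                  (γG τG : Fin (nE G) → OrderedCommRing.Carrier S) (γH τH : Fin (nE H) → OrderedCommRing.Carrier S) where

  open import Data.List using (_++_)

  open OrderedCommRingProperties S
  open WedgeStructure G v H rH
  open WalkProperties using (initVerts)

  root : Fin (k ℕ.+ m)
  root = ιG r

  LW : List (Fin (nE W)) → Carrier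
  LW = L W S (joinW γG γH)

  LG : List (Fin (nE G)) → Carrier
  LG = L G S γG

  LH : List (Fin (nE H)) → Carrier
  LH = L H S γH

  joinW-εG : ∀ {A : Set} (f : Fin (nE G) → A) (g : Fin (nE H) → A) e → joinW f g (εG e) ≡ f e
  joinW-εG f g e = ≡.cong [ f , g ]′ (Finₚ.splitAt-↑ˡ (nE G) e (nE H))

  joinW-εH : ∀ {A : Set} (f : Fin (nE G) → A) (g : Fin (nE H) → A) e → joinW f g (εH e) ≡ g e
  joinW-εH f g e = ≡.cong [ f , g ]′ (Finₚ.splitAt-↑ʳ (nE G) (nE H) e)

  LW-εG : ∀ es → LW (map εG es) ≡ LG es
  LW-εG []       = ≡.refl
  LW-εG (e ∷ es) = ≡.cong₂ _+_ (joinW-εG γG γH e) (LW-εG es)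

  LW-εH : ∀ es → LW (map εH es) ≡ LH es
  LW-εH []       = ≡.refl
  LW-εH (e ∷ es) = ≡.cong₂ _+_ (joinW-εH γG γH e) (LW-εH es)

  module Lift (TG : Subset (nE G)) (TH : Subset (nE H))
              (pathsG : ∀ a → TreePath G r TG a) (pathsH : ∀ x → TreePath H rH TH x) where

    T : Subset (nE W)
    T = TG Vec.++ TH

    InT-εG : ∀ es → All (λ e → lookup TG e ≡ true) es → All (λ e → lookup T e ≡ true) (map εG es)
    InT-εG es a = Allₚ.map⁺ (All.map (λ TGe → ≡.trans (Vecₚ.lookup-++ˡ TG TH _) TGe) a)

    InT-εH : ∀ es → All (λ e → lookup TH e ≡ true) es → All (λ e → lookup T e ≡ true) (map εH es)
    InT-εH es a = Allₚ.map⁺ (All.map (λ THe → ≡.trans (Vecₚ.lookup-++ʳ TG TH _) THe) a)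

    pathToG : ∀ a → TreePath W root T (ιG a)
    pathToG a = (liftG q , ≡.subst Unique (≡.sym (verts-liftG q)) (Uniqueₚ.map⁺ ιG-injective q!)) ,
                ≡.subst (All _) (≡.sym (edges-liftG q)) (InT-εG _ (proj₂ (pathsG a)))
      where
      q : Walk G r a
      q = proj₁ (proj₁ (pathsG a))
      q! : Unique (verts G q)
      q! = proj₂ (proj₁ (pathsG a))

    pathToH : ∀ j → TreePath W root T (k ↑ʳ j)
    pathToH j = (walk , walk!) , walkInT
      where
      open WalkProperties W using (_++ʷ_; castʷ; edges-++ʷ; verts-++ʷ; edges-castʷ; verts-castʷ)
      x : Fin (suc m)
      x = punchIn rH j
      q : Walk G r v
      q = proj₁ (proj₁ (pathsG v))
      h : Walk H rH x
      h = proj₁ (proj₁ (pathsH x))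
      liftedH : Walk W (ιG v) (k ↑ʳ j)
      liftedH = castʷ ιH-root (ιH-punchIn j) (liftH h)
      walk : Walk W root (k ↑ʳ j)
      walk = liftG q ++ʷ liftedH
      initq! : Unique (initVerts G q) × v ∉ initVerts G q
      initq! = WalkProperties.Unique-initVerts G q (proj₂ (proj₁ (pathsG v)))
      disjoint : ∀ {z} → z ∈ map ιG (initVerts G q) → z ∉ map ιH (verts H h)
      disjoint z∈G z∈H with ∈-map⁻ ιG z∈G | ∈-map⁻ ιH z∈H
      ... | a , a∈ , ≡.refl | y , _ , ιGa≡ιHy with ιH≡ιG⇒root (≡.sym ιGa≡ιHy)
      ...   | _ , ≡.refl = proj₂ initq! a∈
      walk! : Unique (verts W walk)
      walk! = ≡.subst Unique
        (≡.sym (≡.trans (verts-++ʷ (liftG q) liftedH)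
                 (≡.cong₂ _++_ (initVerts-liftG q) (≡.trans (verts-castʷ ιH-root (ιH-punchIn j) (liftH h)) (verts-liftH h)))))
        (Uniqueₚ.++⁺ (Uniqueₚ.map⁺ ιG-injective (proj₁ initq!))
                     (Uniqueₚ.map⁺ ιH-injective (proj₂ (proj₁ (pathsH x))))
                     (λ (z∈G , z∈H) → disjoint z∈G z∈H))
      walkInT : All (λ e → lookup T e ≡ true) (edges W walk)
      walkInT = ≡.subst (All _)
        (≡.sym (≡.trans (edges-++ʷ (liftG q) liftedH)
                 (≡.cong₂ _++_ (edges-liftG q) (≡.trans (edges-castʷ ιH-root (ιH-punchIn j) (liftH h)) (edges-liftH h)))))
        (Allₚ.++⁺ (InT-εG _ (proj₂ (pathsG v))) (InT-εH _ (proj₂ (pathsH x))))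

    paths : ∀ w → TreePath W root T w
    paths w with wedgeVertex w
    ... | inG a = pathToG a
    ... | inH j = pathToH j

  module Restrict (U : Subset (nE W)) (UG : Subset (nE G)) (UH : Subset (nE H)) (U≡ : U ≡ UG Vec.++ UH)
                  (paths : ∀ w → TreePath W root U w) where

    lookup-εG : ∀ e → lookup U (εG e) ≡ lookup UG e
    lookup-εG e rewrite U≡ = Vecₚ.lookup-++ˡ UG UH e

    lookup-εH : ∀ f → lookup U (εH f) ≡ lookup UH f
    lookup-εH f rewrite U≡ = Vecₚ.lookup-++ʳ UG UH f

    InUG : ∀ es → All (λ e → lookup U e ≡ true) (map εG es) → All (λ e → lookup UG e ≡ true) es
    InUG es a = All.map (λ {e} Ue → ≡.trans (≡.sym (lookup-εG e)) Ue) (Allₚ.map⁻ a)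

    InUH : ∀ es → All (λ e → lookup U e ≡ true) (map εH es) → All (λ e → lookup UH e ≡ true) es
    InUH es a = All.map (λ {e} Ue → ≡.trans (≡.sym (lookup-εH e)) Ue) (Allₚ.map⁻ a)

    walkTo : ∀ w → Walk W root w
    walkTo w = proj₁ (proj₁ (paths w))

    walkTo! : ∀ w → Unique (verts W (walkTo w))
    walkTo! w = proj₂ (proj₁ (paths w))

    walkToInU : ∀ w → All (λ e → lookup U e ≡ true) (edges W (walkTo w))
    walkToInU w = proj₂ (paths w)

    restrictedToG : ∀ a → Σ (Walk G r a) λ q → edges W (walkTo (ιG a)) ≡ map εG (edges G q) ×
                                                verts W (walkTo (ιG a)) ≡ map ιG (verts G q)
    restrictedToG a = restrictG (walkTo (ιG a)) ≡.refl ≡.refl (walkTo! (ιG a))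

    pathsG : ∀ a → TreePath G r UG a
    pathsG a with restrictedToG a
    ... | q , edges≡ , verts≡ = (q , Uniqueₚ.map⁻ (≡.subst Unique verts≡ (walkTo! (ιG a)))) ,
                                InUG _ (≡.subst (All _) edges≡ (walkToInU (ιG a)))

    LW-pathToG : ∀ a → LW (edges W (walkTo (ιG a))) ≡ LG (pedges G (proj₁ (pathsG a)))
    LW-pathToG a = ≡.trans (≡.cong LW (proj₁ (proj₂ (restrictedToG a)))) (LW-εG (edges G (proj₁ (restrictedToG a))))

    module PathToH (x : Fin (suc m)) (rH≢x : rH ≢ x) where

      pieces : Σ (Walk G r v) λ q → Σ (Walk H rH x) λ h →
                 edges W (walkTo (ιH x)) ≡ map εG (edges G q) ++ map εH (edges H h) ×
                 verts W (walkTo (ιH x)) ≡ map ιG (initVerts G q) ++ map ιH (verts H h)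
      pieces = split-at-v (walkTo (ιH x)) ≡.refl ≡.refl rH≢x (walkTo! (ιH x))

      q : Walk G r v
      q = proj₁ pieces

      h : Walk H rH x
      h = proj₁ (proj₂ pieces)

      separated : Unique (map ιG (initVerts G q)) × Unique (map ιH (verts H h)) ×
                  (∀ {z} → z ∈ map ιG (initVerts G q) → z ∉ map ιH (verts H h))
      separated = Unique-++⁻ _ _ (≡.subst Unique (proj₂ (proj₂ (proj₂ pieces))) (walkTo! (ιH x)))

      v∉initq : v ∉ initVerts G q
      v∉initq v∈ = proj₂ (proj₂ separated) (∈-map⁺ ιG v∈)
                     (≡.subst (_∈ map ιH (verts H h)) ιH-root (∈-map⁺ ιH (WalkProperties.head∈verts H h)))

      q! : Unique (verts G q)
      q! = ≡.subst Unique (≡.sym (WalkProperties.verts≡initVerts∷ʳ G q))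
             (Uniqueₚ.++⁺ (Uniqueₚ.map⁻ (proj₁ separated)) ([] ∷ [])
                          (λ { (z∈ , here ≡.refl) → v∉initq z∈ }))

      inU : All (λ e → lookup U e ≡ true) (map εG (edges G q)) × All (λ e → lookup U e ≡ true) (map εH (edges H h))
      inU = Allₚ.++⁻ (map εG (edges G q)) (≡.subst (All _) (proj₁ (proj₂ (proj₂ pieces))) (walkToInU (ιH x)))

      gPart : TreePath G r UG v
      gPart = (q , q!) , InUG _ (proj₁ inU)

      hPart : TreePath H rH UH x
      hPart = (h , Uniqueₚ.map⁻ (proj₁ (proj₂ separated))) , InUH _ (proj₂ inU)

      LW-split : LW (edges W (walkTo (ιH x))) ≈ LG (pedges G (proj₁ gPart)) + LH (pedges H (proj₁ hPart))
      LW-split = begin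
        LW (edges W (walkTo (ιH x)))                       ≡⟨ ≡.cong LW (proj₁ (proj₂ (proj₂ pieces))) ⟩
        LW (map εG (edges G q) ++ map εH (edges H h))      ≈⟨ PathLengthProperties.L-++ S W (joinW γG γH) (map εG (edges G q)) _ ⟩
        LW (map εG (edges G q)) + LW (map εH (edges H h))  ≡⟨ ≡.cong₂ _+_ (LW-εG (edges G q)) (LW-εH (edges H h)) ⟩
        LG (edges G q) + LH (edges H h)                    ∎
        where open ≈-Reasoning

    pathsH : ∀ x → TreePath H rH UH x
    pathsH x with root? x
    ... | inj₁ ≡.refl = (nil , [] ∷ []) , []
    ... | inj₂ rH≢x   = PathToH.hPart x rH≢x

    pathToV : ∀ x → TreePath G r UG v
    pathToV x with root? x
    ... | inj₁ _    = pathsG v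
    ... | inj₂ rH≢x = PathToH.gPart x rH≢x

    LW-pathToH : ∀ x → rH ≢ x →
                 LW (edges W (walkTo (ιH x))) ≈ LG (pedges G (proj₁ (pathToV x))) + LH (pedges H (proj₁ (pathsH x)))
    LW-pathToH x rH≢x with root? x
    ... | inj₁ rH≡x  = ⊥-elim (rH≢x rH≡x)
    ... | inj₂ rH≢x′ = PathToH.LW-split x rH≢x′

    LH-pathsH-root : LH (pedges H (proj₁ (pathsH rH))) ≈ 0#
    LH-pathsH-root with root? rH
    ... | inj₁ ≡.refl = ≈-refl
    ... | inj₂ rH≢rH  = ⊥-elim (rH≢rH ≡.refl)

    ΣtoV : Carrier
    ΣtoV = sumFin (λ j → LG (pedges G (proj₁ (pathToV (punchIn rH j)))))

    -- Every non-root vertex of H is reached through v, so its distance splits as (r → v) + (rH → x).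
    cost-decomposition : cost W S (joinW γG γH) (joinW τG τH) root U paths ≈
                         (cost G S γG τG r UG pathsG + cost H S γH τH rH UH pathsH) + ΣtoV
    cost-decomposition = begin
      cost W S (joinW γG γH) (joinW τG τH) root U paths ≈⟨ +-cong trenches distances ⟩
      (τsumG + τsumH) + (dsumG + (ΣtoV + dsumH))          ≈⟨ regroup τsumG τsumH dsumG ΣtoV dsumH ⟩
      ((τsumG + dsumG) + (τsumH + dsumH)) + ΣtoV          ≈⟨ +-congʳ (+-congˡ (+-congˡ (≈-sym H-distances))) ⟩
      (cost G S γG τG r UG pathsG + cost H S γH τH rH UH pathsH) + ΣtoV ∎
      where
      open ≈-Reasoning
      τsumG τsumH dsumG dsumH : Carrier
      τsumG = sumFin (λ e → if lookup UG e then τG e else 0#)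
      τsumH = sumFin (λ e → if lookup UH e then τH e else 0#)
      dsumG = sumFin (λ a → LG (pedges G (proj₁ (pathsG a))))
      dsumH = sumFin (λ j → LH (pedges H (proj₁ (pathsH (punchIn rH j)))))
      trenches : sumFin (λ e → if lookup U e then joinW τG τH e else 0#) ≈ τsumG + τsumH
      trenches = ≈-trans (sumFin-↑ (nE G) _)
        (+-cong (sumFin-cong λ e → reflexive (≡.cong₂ (λ b t → if b then t else 0#) (lookup-εG e) (joinW-εG τG τH e)))
                (sumFin-cong λ f → reflexive (≡.cong₂ (λ b t → if b then t else 0#) (lookup-εH f) (joinW-εH τG τH f))))
      distanceToH : ∀ j → LW (edges W (walkTo (k ↑ʳ j))) ≈
                          LG (pedges G (proj₁ (pathToV (punchIn rH j)))) + LH (pedges H (proj₁ (pathsH (punchIn rH j))))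
      distanceToH j = ≈-trans (reflexive (≡.cong (λ w → LW (edges W (walkTo w))) (≡.sym (ιH-punchIn j))))
                              (LW-pathToH (punchIn rH j) (λ rH≡ → Finₚ.punchInᵢ≢i rH j (≡.sym rH≡)))
      distances : sumFin (λ w → LW (edges W (walkTo w))) ≈ dsumG + (ΣtoV + dsumH)
      distances = ≈-trans (sumFin-↑ k _)
        (+-cong (sumFin-cong (λ a → reflexive (LW-pathToG a)))
                (≈-trans (sumFin-cong distanceToH)
                         (sumFin-+ (λ j → LG (pedges G (proj₁ (pathToV (punchIn rH j)))))
                                   (λ j → LH (pedges H (proj₁ (pathsH (punchIn rH j))))))))
      H-distances : sumFin (λ x → LH (pedges H (proj₁ (pathsH x)))) ≈ dsumH
      H-distances = ≈-trans (sumFin-punchIn rH (λ x → LH (pedges H (proj₁ (pathsH x)))))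
                            (≈-trans (+-congʳ LH-pathsH-root) (+-identityˡ _))
      regroup : ∀ a b c d e → (a + b) + (c + (d + e)) ≈ ((a + c) + (b + e)) + d
      regroup = solve 5 (λ a b c d e → ((a ⊕ b) ⊕ (c ⊕ (d ⊕ e))) ⊜ (((a ⊕ c) ⊕ (b ⊕ e)) ⊕ d)) ≈-refl
        where open Solver

    cost-split : (∀ (R R′ : TreePath G r UG v) → LG (pedges G (proj₁ R)) ≈ LG (pedges G (proj₁ R′))) →
                 cost W S (joinW γG γH) (joinW τG τH) root U paths ≈
                 (cost G S γG τG r UG pathsG + m · LG (pedges G (proj₁ (pathsG v)))) + cost H S γH τH rH UH pathsH
    cost-split uniform = begin
      cost W S (joinW γG γH) (joinW τG τH) root U paths
        ≈⟨ cost-decomposition ⟩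
      (cost G S γG τG r UG pathsG + cost H S γH τH rH UH pathsH) + ΣtoV
        ≈⟨ +-congˡ (≈-trans (sumFin-cong (λ j → uniform (pathToV (punchIn rH j)) (pathsG v))) (sumFin-const m _)) ⟩
      (cost G S γG τG r UG pathsG + cost H S γH τH rH UH pathsH) + m · LG (pedges G (proj₁ (pathsG v)))
        ≈⟨ xy∙z≈xz∙y _ _ _ ⟩
      (cost G S γG τG r UG pathsG + m · LG (pedges G (proj₁ (pathsG v)))) + cost H S γH τH rH UH pathsH ∎
      where open ≈-Reasoning

module CycleStructure (k : ℕ) .{{_ : NonZero k}} (k≥3 : 3 ℕ.≤ k) (r : Fin k) where

  open import Data.Nat using (_+_; _∸_; _<_; _≤_; pred; z≤n; s≤s)

  %-absorbʳ : ∀ a b → (a + b % k) % k ≡ (a + b) % k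
  %-absorbʳ a b = begin
    (a + b % k) % k          ≡⟨ %-distribˡ-+ a (b % k) k ⟩
    (a % k + b % k % k) % k  ≡⟨ ≡.cong (λ z → (a % k + z) % k) (m%n%n≡m%n b k) ⟩
    (a % k + b % k) % k      ≡⟨ %-distribˡ-+ a b k ⟨
    (a + b) % k              ∎
    where open ≡.≡-Reasoning

  r+[k∸r] : toℕ r + (k ∸ toℕ r) ≡ k
  r+[k∸r] = ℕₚ.m+[n∸m]≡n (ℕₚ.<⇒≤ (Finₚ.toℕ<n r))

  node : ℕ → Fin k
  node j = (toℕ r + j) mod k

  toℕ-node : ∀ j → toℕ (node j) ≡ (toℕ r + j) % k
  toℕ-node j = Finₚ.toℕ-fromℕ< _

  next : Fin k → Fin k
  next y = suc (toℕ y) mod k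

  next-node : ∀ j → next (node j) ≡ node (suc j)
  next-node j = Finₚ.toℕ-injective (begin
    toℕ (next (node j))         ≡⟨ Finₚ.toℕ-fromℕ< _ ⟩
    (1 + toℕ (node j)) % k      ≡⟨ ≡.cong (λ z → (1 + z) % k) (toℕ-node j) ⟩
    (1 + (toℕ r + j) % k) % k   ≡⟨ %-absorbʳ 1 (toℕ r + j) ⟩
    (1 + (toℕ r + j)) % k       ≡⟨ ≡.cong (_% k) (ℕₚ.+-suc (toℕ r) j) ⟨
    (toℕ r + suc j) % k         ≡⟨ toℕ-node (suc j) ⟨
    toℕ (node (suc j))          ∎)
    where open ≡.≡-Reasoning

  unrotate : ∀ i → ((toℕ r + i) % k + (k ∸ toℕ r)) % k ≡ i % k
  unrotate i = begin
    ((toℕ r + i) % k + (k ∸ toℕ r)) % k  ≡⟨ ≡.cong (_% k) (ℕₚ.+-comm ((toℕ r + i) % k) (k ∸ toℕ r)) ⟩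
    ((k ∸ toℕ r) + (toℕ r + i) % k) % k  ≡⟨ %-absorbʳ (k ∸ toℕ r) (toℕ r + i) ⟩
    ((k ∸ toℕ r) + (toℕ r + i)) % k      ≡⟨ ≡.cong (_% k) (ℕₚ.+-assoc (k ∸ toℕ r) (toℕ r) i) ⟨
    ((k ∸ toℕ r) + toℕ r + i) % k        ≡⟨ ≡.cong (λ z → (z + i) % k) (≡.trans (ℕₚ.+-comm (k ∸ toℕ r) (toℕ r)) r+[k∸r]) ⟩
    (k + i) % k                          ≡⟨ ≡.cong (_% k) (ℕₚ.+-comm k i) ⟩
    (i + k) % k                          ≡⟨ [m+n]%n≡m%n i k ⟩
    i % k                                ∎
    where open ≡.≡-Reasoning

  node-injective : ∀ {i j} → i < k → j < k → node i ≡ node j → i ≡ j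
  node-injective {i} {j} i<k j<k eq = begin
    i                                    ≡⟨ m<n⇒m%n≡m i<k ⟨
    i % k                                ≡⟨ unrotate i ⟨
    ((toℕ r + i) % k + (k ∸ toℕ r)) % k  ≡⟨ ≡.cong (λ z → (z + (k ∸ toℕ r)) % k) rotated≡ ⟩
    ((toℕ r + j) % k + (k ∸ toℕ r)) % k  ≡⟨ unrotate j ⟩
    j % k                                ≡⟨ m<n⇒m%n≡m j<k ⟩
    j                                    ∎
    where
    open ≡.≡-Reasoning
    rotated≡ : (toℕ r + i) % k ≡ (toℕ r + j) % k
    rotated≡ = ≡.trans (≡.sym (toℕ-node i)) (≡.trans (≡.cong toℕ eq) (toℕ-node j))

  node-k : node k ≡ node 0
  node-k = Finₚ.toℕ-injective (begin
    toℕ (node k)         ≡⟨ toℕ-node k ⟩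
    (toℕ r + k) % k      ≡⟨ [m+n]%n≡m%n (toℕ r) k ⟩
    toℕ r % k            ≡⟨ ≡.cong (_% k) (ℕₚ.+-identityʳ (toℕ r)) ⟨
    (toℕ r + 0) % k      ≡⟨ toℕ-node 0 ⟨
    toℕ (node 0)         ∎)
    where open ≡.≡-Reasoning

  node-0 : node 0 ≡ r
  node-0 = Finₚ.toℕ-injective (≡.trans (toℕ-node 0)
             (≡.trans (≡.cong (_% k) (ℕₚ.+-identityʳ (toℕ r))) (m<n⇒m%n≡m (Finₚ.toℕ<n r))))

  node-surjective : ∀ x → ∃ λ j → j < k × x ≡ node j
  node-surjective x = (toℕ x + (k ∸ toℕ r)) % k , m%n<n _ k , Finₚ.toℕ-injective (≡.sym (begin
    toℕ (node ((toℕ x + (k ∸ toℕ r)) % k))    ≡⟨ toℕ-node _ ⟩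
    (toℕ r + (toℕ x + (k ∸ toℕ r)) % k) % k   ≡⟨ %-absorbʳ (toℕ r) (toℕ x + (k ∸ toℕ r)) ⟩
    (toℕ r + (toℕ x + (k ∸ toℕ r))) % k       ≡⟨ ≡.cong (_% k) (x∙yz≈y∙xz (toℕ r) (toℕ x) (k ∸ toℕ r)) ⟩
    (toℕ x + (toℕ r + (k ∸ toℕ r))) % k       ≡⟨ ≡.cong (λ z → (toℕ x + z) % k) r+[k∸r] ⟩
    (toℕ x + k) % k                           ≡⟨ [m+n]%n≡m%n (toℕ x) k ⟩
    toℕ x % k                                 ≡⟨ m<n⇒m%n≡m (Finₚ.toℕ<n x) ⟩
    toℕ x                                     ∎))
    where
    open ≡.≡-Reasoning
    open CommSemigroupProperties ℕₚ.+-commutativeSemigroup using (x∙yz≈y∙xz)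

  0<k : 0 < k
  0<k = ℕₚ.<-≤-trans (s≤s z≤n) k≥3

  Joins-Cycle⁻ : ∀ {e x u} → Joins (Cycle k) e x u → (e ≡ x × u ≡ next x) ⊎ (u ≡ e × next u ≡ x)
  Joins-Cycle⁻ (inj₁ ≡.refl) = inj₁ (≡.refl , ≡.refl)
  Joins-Cycle⁻ (inj₂ ≡.refl) = inj₂ (≡.refl , ≡.refl)

  next≡node⇒ : ∀ {i e} → i < k → next e ≡ node i → (1 ≤ i × e ≡ node (pred i)) ⊎ (i ≡ 0 × e ≡ node (k ∸ 1))
  next≡node⇒ {i} {e} i<k next-e≡ with node-surjective e
  ... | j , j<k , ≡.refl with ℕₚ.m≤n⇒m<n∨m≡n j<k
  ...   | inj₁ 1+j<k = inj₁ (≡.subst (1 ≤_) 1+j≡i (s≤s z≤n) , ≡.cong (λ l → node (pred l)) 1+j≡i)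
    where
    1+j≡i : suc j ≡ i
    1+j≡i = node-injective 1+j<k i<k (≡.trans (≡.sym (next-node j)) next-e≡)
  ...   | inj₂ 1+j≡k = inj₂ (i≡0 , ≡.cong (λ l → node (pred l)) 1+j≡k)
    where
    i≡0 : i ≡ 0
    i≡0 = node-injective i<k 0<k (≡.trans (≡.sym next-e≡) (≡.trans (next-node j) (≡.trans (≡.cong node 1+j≡k) node-k)))

  node-neighbours : ∀ i {e u} → i < k → Joins (Cycle k) e (node i) u →
                    (e ≡ node i × u ≡ node (suc i)) ⊎
                    (1 ≤ i × e ≡ node (pred i) × u ≡ e) ⊎
                    (i ≡ 0 × e ≡ node (k ∸ 1) × u ≡ e)
  node-neighbours i i<k J with Joins-Cycle⁻ J
  ... | inj₁ (≡.refl , ≡.refl) = inj₁ (≡.refl , next-node i)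
  ... | inj₂ (≡.refl , next-u≡) with next≡node⇒ i<k next-u≡
  ...   | inj₁ (1≤i , e≡) = inj₂ (inj₁ (1≤i , e≡ , ≡.refl))
  ...   | inj₂ (i≡0 , e≡) = inj₂ (inj₂ (i≡0 , e≡ , ≡.refl))

  -- A traversal of the cycle starting at r: V j is the j-th vertex and E j the edge from V j to V (j + 1).
  record Orientation : Set where
    field
      V E          : ℕ → Fin k
      V-injective  : ∀ {i j} → i < k → j < k → V i ≡ V j → i ≡ j
      E-injective  : ∀ {i j} → i < k → j < k → E i ≡ E j → i ≡ j
      V-surjective : ∀ x → ∃ λ j → j < k × x ≡ V j
      E-surjective : ∀ x → ∃ λ j → j < k × x ≡ E j
      V-0          : V 0 ≡ r
      V-k          : V k ≡ V 0
      E-joins      : ∀ i → i < k → Joins (Cycle k) (E i) (V i) (V (suc i))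
      neighbours   : ∀ i {e u} → 1 ≤ i → i < k → Joins (Cycle k) e (V i) u →
                     (e ≡ E i × u ≡ V (suc i)) ⊎ (e ≡ E (pred i) × u ≡ V (pred i))

  forward : Orientation
  forward = record
    { V = node ; E = node
    ; V-injective = node-injective ; E-injective = node-injective
    ; V-surjective = node-surjective ; E-surjective = node-surjective
    ; V-0 = node-0 ; V-k = node-k
    ; E-joins = λ i _ → inj₁ (≡.cong (node i ,_) (next-node i))
    ; neighbours = neighbours
    }
    where
    neighbours : ∀ i {e u} → 1 ≤ i → i < k → Joins (Cycle k) e (node i) u →
                 (e ≡ node i × u ≡ node (suc i)) ⊎ (e ≡ node (pred i) × u ≡ node (pred i))
    neighbours i 1≤i i<k J with node-neighbours i i<k J
    ... | inj₁ fwd                      = inj₁ fwd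
    ... | inj₂ (inj₁ (_ , e≡ , ≡.refl)) = inj₂ (e≡ , e≡)
    ... | inj₂ (inj₂ (≡.refl , _))      = case 1≤i of λ ()

  1+[k∸1+i] : ∀ {i} → i < k → suc (k ∸ suc i) ≡ k ∸ i
  1+[k∸1+i] i<k = ≡.sym (ℕₚ.+-∸-assoc 1 i<k)

  k∸1+i<k : ∀ {i} → i < k → k ∸ suc i < k
  k∸1+i<k i<k = ℕₚ.∸-monoʳ-< (s≤s z≤n) i<k

  k∸[k∸1+i]≡1+i : ∀ {i} → i < k → k ∸ (k ∸ suc i) ≡ suc i
  k∸[k∸1+i]≡1+i i<k = ℕₚ.m∸[m∸n]≡n i<k

  backward : Orientation
  backward = record
    { V = λ j → node (k ∸ j) ; E = λ j → node (k ∸ suc j)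
    ; V-injective = V-injective ; E-injective = E-injective
    ; V-surjective = V-surjective ; E-surjective = E-surjective
    ; V-0 = ≡.trans node-k node-0 ; V-k = ≡.trans (≡.cong node (ℕₚ.n∸n≡0 k)) (≡.sym node-k)
    ; E-joins = λ i i<k →
        inj₂ (≡.cong (node (k ∸ suc i) ,_) (≡.trans (next-node (k ∸ suc i)) (≡.cong node (1+[k∸1+i] i<k))))
    ; neighbours = neighbours
    }
    where
    V-surjective : ∀ x → ∃ λ j → j < k × x ≡ node (k ∸ j)
    V-surjective x with node-surjective x
    ... | zero  , _   , x≡ = 0 , 0<k , ≡.trans x≡ (≡.sym node-k)
    ... | suc j , j<k , x≡ =
      k ∸ suc j , k∸1+i<k (ℕₚ.<⇒≤ j<k) , ≡.trans x≡ (≡.cong node (≡.sym (k∸[k∸1+i]≡1+i (ℕₚ.<⇒≤ j<k))))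
    E-surjective : ∀ x → ∃ λ j → j < k × x ≡ node (k ∸ suc j)
    E-surjective x with node-surjective x
    ... | j , j<k , x≡ = k ∸ suc j , k∸1+i<k j<k ,
                         ≡.trans x≡ (≡.cong node (≡.sym (≡.trans (≡.cong (k ∸_) (1+[k∸1+i] j<k)) (ℕₚ.m∸[m∸n]≡n (ℕₚ.<⇒≤ j<k)))))
    V-injective : ∀ {i j} → i < k → j < k → node (k ∸ i) ≡ node (k ∸ j) → i ≡ j
    V-injective {zero}  {zero}  _   _   _  = ≡.refl
    V-injective {zero}  {suc j} _   j<k eq = ⊥-elim (ℕₚ.<⇒≢ (ℕₚ.m<n⇒0<n∸m j<k)
                                               (node-injective 0<k (k∸1+i<k (ℕₚ.<⇒≤ j<k)) (≡.trans (≡.sym node-k) eq)))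
    V-injective {suc i} {zero}  i<k _   eq = ⊥-elim (ℕₚ.<⇒≢ (ℕₚ.m<n⇒0<n∸m i<k)
                                               (node-injective 0<k (k∸1+i<k (ℕₚ.<⇒≤ i<k)) (≡.trans (≡.sym node-k) (≡.sym eq))))
    V-injective {suc i} {suc j} i<k j<k eq = ℕₚ.∸-cancelˡ-≡ (ℕₚ.<⇒≤ i<k) (ℕₚ.<⇒≤ j<k)
                                               (node-injective (k∸1+i<k (ℕₚ.<⇒≤ i<k)) (k∸1+i<k (ℕₚ.<⇒≤ j<k)) eq)
    E-injective : ∀ {i j} → i < k → j < k → node (k ∸ suc i) ≡ node (k ∸ suc j) → i ≡ j
    E-injective i<k j<k eq = ℕₚ.suc-injective (ℕₚ.∸-cancelˡ-≡ i<k j<k (node-injective (k∸1+i<k i<k) (k∸1+i<k j<k) eq))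
    neighbours : ∀ i {e u} → 1 ≤ i → i < k → Joins (Cycle k) e (node (k ∸ i)) u →
                 (e ≡ node (k ∸ suc i) × u ≡ node (k ∸ suc i)) ⊎ (e ≡ node (k ∸ suc (pred i)) × u ≡ node (k ∸ pred i))
    neighbours (suc i) (s≤s z≤n) i<k J
      with Orientation.neighbours forward (k ∸ suc i) (ℕₚ.m<n⇒0<n∸m i<k) (k∸1+i<k (ℕₚ.<⇒≤ i<k)) J
    ... | inj₁ (e≡ , u≡) = inj₂ (e≡ , ≡.trans u≡ (≡.cong node (1+[k∸1+i] (ℕₚ.<-trans (ℕₚ.n<1+n i) i<k))))
    ... | inj₂ (e≡ , u≡) = inj₁ (≡.trans e≡ (≡.cong node (ℕₚ.pred[m∸n]≡m∸[1+n] k (suc i))) ,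
                                 ≡.trans u≡ (≡.cong node (ℕₚ.pred[m∸n]≡m∸[1+n] k (suc i))))

  -- The two traversals from r; swap lets every lemma about the fwd one apply to either direction.
  record OppositeOrientations : Set where
    field
      fwd bwd : Orientation
    open Orientation fwd public
    module B = Orientation bwd
    field
      root-neighbours : ∀ {e u} → Joins (Cycle k) e (V 0) u → (e ≡ E 0 × u ≡ V 1) ⊎ (e ≡ B.E 0 × u ≡ B.V 1)
      B-V : ∀ j → j ≤ k → B.V j ≡ V (k ∸ j)
      B-E : ∀ j → j < k → B.E j ≡ E (k ∸ suc j)

  standard : OppositeOrientations
  standard = record
    { fwd = forward ; bwd = backward
    ; root-neighbours = root-neighbours ; B-V = λ _ _ → ≡.refl ; B-E = λ _ _ → ≡.refl }
    where
    root-neighbours : ∀ {e u} → Joins (Cycle k) e (node 0) u →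
                      (e ≡ node 0 × u ≡ node 1) ⊎ (e ≡ node (k ∸ 1) × u ≡ node (k ∸ 1))
    root-neighbours J with node-neighbours 0 0<k J
    ... | inj₁ fwd                      = inj₁ fwd
    ... | inj₂ (inj₁ (() , _))
    ... | inj₂ (inj₂ (_ , e≡ , ≡.refl)) = inj₂ (e≡ , e≡)

  swap : OppositeOrientations → OppositeOrientations
  swap O = record
    { fwd = bwd ; bwd = fwd
    ; root-neighbours = root-neighbours′ ; B-V = B-V′ ; B-E = B-E′ }
    where
    open OppositeOrientations O
    root-neighbours′ : ∀ {e u} → Joins (Cycle k) e (B.V 0) u → (e ≡ B.E 0 × u ≡ B.V 1) ⊎ (e ≡ E 0 × u ≡ V 1)
    root-neighbours′ J with root-neighbours (≡.subst (λ z → Joins (Cycle k) _ z _) (≡.trans B.V-0 (≡.sym V-0)) J)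
    ... | inj₁ fwd = inj₂ fwd
    ... | inj₂ bwd = inj₁ bwd
    B-V′ : ∀ j → j ≤ k → V j ≡ B.V (k ∸ j)
    B-V′ j j≤k = ≡.sym (≡.trans (B-V (k ∸ j) (ℕₚ.m∸n≤m k j)) (≡.cong V (ℕₚ.m∸[m∸n]≡n j≤k)))
    B-E′ : ∀ j → j < k → E j ≡ B.E (k ∸ suc j)
    B-E′ j j<k = ≡.sym (≡.trans (B-E (k ∸ suc j) (k∸1+i<k j<k))
                               (≡.cong E (≡.trans (≡.cong (k ∸_) (1+[k∸1+i] j<k)) (ℕₚ.m∸[m∸n]≡n (ℕₚ.<⇒≤ j<k)))))

  open WalkProperties (Cycle k) using (head∈verts; castʷ; edges-castʷ; verts-castʷ)

  module OrientationProperties (O : Orientation) where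
    open Orientation O

    IsArc : ∀ (i : ℕ) {s w} → Walk (Cycle k) s w → Set
    IsArc i {w = w} p = ∃ λ n → i + n < k × w ≡ V (i + n) × edges (Cycle k) p ≡ map E (range i n)

    runs-forward : ∀ i {s w} (p : Walk (Cycle k) s w) → s ≡ V i → 1 ≤ i → i < k → Unique (verts (Cycle k) p) →
                   (∀ t → t < i → V t ∉ verts (Cycle k) p) → IsArc i p
    runs-forward i nil ≡.refl _ i<k _ _ =
      0 , ≡.subst (_< k) (≡.sym (ℕₚ.+-identityʳ i)) i<k , ≡.cong V (≡.sym (ℕₚ.+-identityʳ i)) , ≡.refl
    runs-forward i@(suc i-1) (cons e J p) ≡.refl 1≤i i<k (s∉p ∷ p!) visited with neighbours i 1≤i i<k J
    ... | inj₂ (_ , ≡.refl) = ⊥-elim (visited i-1 (ℕₚ.n<1+n i-1) (there (head∈verts p)))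
    ... | inj₁ (≡.refl , ≡.refl) with ℕₚ.m≤n⇒m<n∨m≡n i<k
    ...   | inj₂ 1+i≡k =
      ⊥-elim (visited 0 1≤i (there (≡.subst (_∈ verts (Cycle k) p) (≡.trans (≡.cong V 1+i≡k) V-k) (head∈verts p))))
    ...   | inj₁ 1+i<k with runs-forward (suc i) p ≡.refl (s≤s z≤n) 1+i<k p! visited′
      where
      visited′ : ∀ t → t < suc i → V t ∉ verts (Cycle k) p
      visited′ t t<1+i t∈ with ℕₚ.m≤n⇒m<n∨m≡n (ℕₚ.≤-pred t<1+i)
      ... | inj₁ t<i    = visited t t<i (there t∈)
      ... | inj₂ ≡.refl = All.lookup s∉p t∈ ≡.refl
    ...     | n , i+n<k , w≡ , edges≡ = suc n , ≡.subst (_< k) (≡.sym (ℕₚ.+-suc i n)) i+n<k ,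
                                        ≡.trans w≡ (≡.cong V (≡.sym (ℕₚ.+-suc i n))) , ≡.cong (_ ∷_) edges≡

    arc : ∀ i n → i + n < k → Σ (Walk (Cycle k) (V i) (V (i + n))) λ p →
          edges (Cycle k) p ≡ map E (range i n) × verts (Cycle k) p ≡ map V (range i (suc n))
    arc i zero    _ = castʷ ≡.refl i≡ nil , edges-castʷ ≡.refl i≡ nil , verts-castʷ ≡.refl i≡ nil
      where
      i≡ : V i ≡ V (i + 0)
      i≡ = ≡.cong V (≡.sym (ℕₚ.+-identityʳ i))
    arc i (suc n) i+n<k with arc (suc i) n (≡.subst (_< k) (ℕₚ.+-suc i n) i+n<k)
    ... | p , edges≡ , verts≡ =
      castʷ ≡.refl i≡ p′ , ≡.trans (edges-castʷ ≡.refl i≡ p′) (≡.cong (E i ∷_) edges≡) ,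
                           ≡.trans (verts-castʷ ≡.refl i≡ p′) (≡.cong (V i ∷_) verts≡)
      where
      i≡ : V (suc i + n) ≡ V (i + suc n)
      i≡ = ≡.cong V (≡.sym (ℕₚ.+-suc i n))
      p′ : Walk (Cycle k) (V i) (V (suc i + n))
      p′ = cons (E i) (E-joins i (ℕₚ.≤-<-trans (ℕₚ.m≤m+n i (suc n)) i+n<k)) p

    Unique-arc : ∀ i n (i+n<k : i + n < k) → Unique (verts (Cycle k) (proj₁ (arc i n i+n<k)))
    Unique-arc i n i+n<k = ≡.subst Unique (≡.sym (proj₂ (proj₂ (arc i n i+n<k))))
      (Unique-map⁺-onAll V V-injective
         (All.tabulate (λ t∈ → ℕₚ.<-≤-trans (proj₂ (∈-range⁻ i (suc n) t∈)) (≡.subst (_≤ k) (≡.sym (ℕₚ.+-suc i n)) i+n<k)))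
         (Unique-range i (suc n)))

    E∈arc⁻ : ∀ {x i l} → x < k → i + l ≤ k → E x ∈ map E (range i l) → i ≤ x × x < i + l
    E∈arc⁻ {x} {i} {l} x<k i+l≤k Ex∈ with ∈-map⁻ E Ex∈
    ... | t , t∈ , Ex≡Et with ∈-range⁻ i l t∈
    ...   | i≤t , t<i+l with E-injective x<k (ℕₚ.<-≤-trans t<i+l i+l≤k) Ex≡Et
    ...     | ≡.refl = i≤t , t<i+l

    E∈arc⁺ : ∀ {x i l} → i ≤ x → x < i + l → E x ∈ map E (range i l)
    E∈arc⁺ {i = i} {l} i≤x x<i+l = ∈-map⁺ E (∈-range⁺ i l i≤x x<i+l)

  module RootPaths (O : OppositeOrientations) where
    open OppositeOrientations O
    open OrientationProperties fwd using (IsArc; runs-forward)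
    module BP = OrientationProperties bwd

    1<k : 1 < k
    1<k = ℕₚ.<-≤-trans (s≤s (s≤s z≤n)) k≥3

    root-path-direction : ∀ {s w} (p : Walk (Cycle k) s w) → s ≡ V 0 → Unique (verts (Cycle k) p) →
                          IsArc 0 p ⊎ BP.IsArc 0 p
    root-path-direction nil ≡.refl _ = inj₁ (0 , 0<k , ≡.refl , ≡.refl)
    root-path-direction (cons e J p) ≡.refl (s∉p ∷ p!) with root-neighbours J
    ... | inj₁ (≡.refl , ≡.refl) with runs-forward 1 p ≡.refl (s≤s z≤n) 1<k p! root-not-revisited
      where
      root-not-revisited : ∀ t → t < 1 → V t ∉ verts (Cycle k) p
      root-not-revisited zero    _         t∈ = All.lookup s∉p t∈ ≡.refl
      root-not-revisited (suc t) (s≤s ()) _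
    ...   | n , n<k , w≡ , edges≡ = inj₁ (suc n , n<k , w≡ , ≡.cong (_ ∷_) edges≡)
    root-path-direction (cons e J p) ≡.refl (s∉p ∷ p!) | inj₂ (≡.refl , ≡.refl)
      with BP.runs-forward 1 p ≡.refl (s≤s z≤n) 1<k p! root-not-revisited
      where
      root-not-revisited : ∀ t → t < 1 → B.V t ∉ verts (Cycle k) p
      root-not-revisited zero    _         t∈ =
        All.lookup s∉p (≡.subst (_∈ verts (Cycle k) p) (≡.trans B.V-0 (≡.sym V-0)) t∈) ≡.refl
      root-not-revisited (suc t) (s≤s ()) _
    ... | n , n<k , w≡ , edges≡ = inj₂ (suc n , n<k , w≡ , ≡.cong (_ ∷_) edges≡)

  root-path-arc : ∀ {w} (R : Path (Cycle k) r w) →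
                  ∃ λ O → ∃ λ s → s < k × pedges (Cycle k) R ≡ map (OppositeOrientations.E O) (range 0 s)
  root-path-arc (walk , walk!) with RootPaths.root-path-direction standard walk (≡.sym node-0) walk!
  ... | inj₁ (s , s<k , _ , edges≡) = standard , s , s<k , edges≡
  ... | inj₂ (s , s<k , _ , edges≡) = swap standard , s , s<k , edges≡

module CycleCosts (k : ℕ) .{{_ : NonZero k}} (k≥3 : 3 ℕ.≤ k) (r : Fin k)
                  (S : OrderedCommRing) (γ τ : Fin k → OrderedCommRing.Carrier S) where

  open import Data.List using (_++_)

  open import Data.Nat using (_∸_; _<_; z≤n; s≤s)
  open CycleStructure k k≥3 r
  open OrderedCommRingProperties S
  open WalkProperties (Cycle k) using (castʷ; edges-castʷ; verts-castʷ)
  open DecMembership (Fin._≟_ {k}) using (_∈?_)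
  open PathLengthProperties S (Cycle k) γ

  -- Instantiated with the costs of G ∖ e₁ and G ∖ e₂ (sharing base = Σ τ) and with
  -- distance-exchange below, the gap is exactly the quantity bounded by the exchange condition.
  exchange-gap : ∀ {c₁ c₂ base t₁ t₂ s₁ s₂ x₁ x₂ l₁ l₂ y₁ y₂} m n →
                 c₁ ≈ (base - t₁) + s₁ → c₂ ≈ (base - t₂) + s₂ → (s₁ + x₁) + suc n · l₁ ≈ (s₂ + suc n · l₂) + x₂ →
                 c₁ + m · y₁ ≈ (c₂ + m · y₂) + (t₂ - t₁ + (l₂ - l₁) + n · (l₂ - l₁) + x₂ - x₁ + m · (y₁ - y₂))
  exchange-gap {c₁} {c₂} {base} {t₁} {t₂} {s₁} {s₂} {x₁} {x₂} {l₁} {l₂} {y₁} {y₂} m n c₁≈ c₂≈ exchange = ≈-sym (begin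
    (c₂ + M₂) + (t₂ - t₁ + (l₂ - l₁) + n · (l₂ - l₁) + x₂ - x₁ + m · (y₁ - y₂))
      ≈⟨ +-cong (+-congʳ c₂≈) (+-cong (+-congʳ (+-congʳ (≈-trans (+-assoc _ _ _) (+-congˡ (·-distrib-- (suc n) l₂ l₁)))))
                                      (·-distrib-- m y₁ y₂)) ⟩
    (((base - t₂) + s₂) + M₂) + (((((t₂ - t₁) + (A₂ - A₁)) + x₂) - x₁) + (M₁ - M₂))
      ≈⟨ regroup₁ base (- t₂) s₂ M₂ t₂ (- t₁) A₂ (- A₁) x₂ (- x₁) M₁ (- M₂) ⟩
    (((base - t₁) + M₁) + (((s₂ + A₂) + x₂) + ((- x₁) + (- A₁)))) + ((t₂ - t₂) + (M₂ - M₂))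
      ≈⟨ +-congʳ (+-congˡ (+-congʳ exchange)) ⟨
    (((base - t₁) + M₁) + (((s₁ + x₁) + A₁) + ((- x₁) + (- A₁)))) + ((t₂ - t₂) + (M₂ - M₂))
      ≈⟨ regroup₂ (base - t₁) M₁ s₁ x₁ A₁ (- x₁) (- A₁) ((t₂ - t₂) + (M₂ - M₂)) ⟩
    (((base - t₁) + s₁) + M₁) + ((x₁ - x₁) + ((A₁ - A₁) + ((t₂ - t₂) + (M₂ - M₂))))
      ≈⟨ +-congˡ (≈-trans (+-cong (-‿inverseʳ x₁) (+-cong (-‿inverseʳ A₁) (+-cong (-‿inverseʳ t₂) (-‿inverseʳ M₂))))
                          (≈-trans (+-identityˡ _) (≈-trans (+-identityˡ _) (+-identityˡ _)))) ⟩
    (((base - t₁) + s₁) + M₁) + 0#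
      ≈⟨ ≈-trans (+-identityʳ _) (+-congʳ (≈-sym c₁≈)) ⟩
    c₁ + M₁ ∎)
    where
    open ≈-Reasoning
    open Solver
    A₁ A₂ M₁ M₂ : Carrier
    A₁ = suc n · l₁
    A₂ = suc n · l₂
    M₁ = m · y₁
    M₂ = m · y₂
    regroup₁ : ∀ b nt₂ s₂ M₂ t₂ nt₁ A₂ nA₁ x₂ nx₁ M₁ nM₂ →
               (((b + nt₂) + s₂) + M₂) + (((((t₂ + nt₁) + (A₂ + nA₁)) + x₂) + nx₁) + (M₁ + nM₂)) ≈
               (((b + nt₁) + M₁) + (((s₂ + A₂) + x₂) + (nx₁ + nA₁))) + ((t₂ + nt₂) + (M₂ + nM₂))
    regroup₁ = solve 12 (λ b nt₂ s₂ M₂ t₂ nt₁ A₂ nA₁ x₂ nx₁ M₁ nM₂ →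
      ((((b ⊕ nt₂) ⊕ s₂) ⊕ M₂) ⊕ (((((t₂ ⊕ nt₁) ⊕ (A₂ ⊕ nA₁)) ⊕ x₂) ⊕ nx₁) ⊕ (M₁ ⊕ nM₂))) ⊜
      ((((b ⊕ nt₁) ⊕ M₁) ⊕ (((s₂ ⊕ A₂) ⊕ x₂) ⊕ (nx₁ ⊕ nA₁))) ⊕ ((t₂ ⊕ nt₂) ⊕ (M₂ ⊕ nM₂)))) ≈-refl
    regroup₂ : ∀ b M₁ s₁ x₁ A₁ nx₁ nA₁ z →
               ((b + M₁) + (((s₁ + x₁) + A₁) + (nx₁ + nA₁))) + z ≈ ((b + s₁) + M₁) + ((x₁ + nx₁) + ((A₁ + nA₁) + z))
    regroup₂ = solve 8 (λ b M₁ s₁ x₁ A₁ nx₁ nA₁ z →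
      (((b ⊕ M₁) ⊕ (((s₁ ⊕ x₁) ⊕ A₁) ⊕ (nx₁ ⊕ nA₁))) ⊕ z) ⊜ (((b ⊕ s₁) ⊕ M₁) ⊕ ((x₁ ⊕ nx₁) ⊕ ((A₁ ⊕ nA₁) ⊕ z)))) ≈-refl

  ExchangeCondition : ℕ → Fin k → Fin k → Set
  ExchangeCondition m e₁ v =
    ∀ (R₁ : Path (Cycle k) r v) → e₁ ∉ pedges (Cycle k) R₁ →
    ∀ e₂ → e₂ ∈ pedges (Cycle k) R₁ →
    ∀ (R₂ : Path (Cycle k) r v) → e₂ ∉ pedges (Cycle k) R₂ →
    ∀ a (P₁ : Path (Cycle k) r a) → EndsWith (Cycle k) e₁ P₁ → e₂ ∉ pedges (Cycle k) P₁ →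
    ∀ b (P₂ : Path (Cycle k) r b) → EndsWith (Cycle k) e₂ P₂ → e₁ ∉ pedges (Cycle k) P₂ →
    ∀ (Q : Path (Cycle k) b a) → e₁ ∉ pedges (Cycle k) Q → e₂ ∉ pedges (Cycle k) Q →
    0# ≥ (τ e₂ - τ e₁
          + (ℓ (pedges (Cycle k) P₂) - ℓ (pedges (Cycle k) P₁))
          + (length (pedges (Cycle k) Q) · (ℓ (pedges (Cycle k) P₂) - ℓ (pedges (Cycle k) P₁)))
          + c (pedges (Cycle k) Q)
          - c (reverse (pedges (Cycle k) Q))
          + (m · (ℓ (pedges (Cycle k) R₁) - ℓ (pedges (Cycle k) R₂))))

  module Along (O : OppositeOrientations) where
    open OppositeOrientations O
    open RootPaths O using (root-path-direction)
    module FP = OrientationProperties fwd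
    module BP = OrientationProperties bwd

    bwd-arc : ∀ l → l ℕ.≤ k → map B.E (range 0 l) ≡ reverse (map E (range (k ∸ l) l))
    bwd-arc zero    _     = ≡.refl
    bwd-arc (suc l) 1+l≤k = begin
      map B.E (range 0 (suc l))
        ≡⟨ ≡.cong (map B.E) (range-∷ʳ 0 l) ⟩
      map B.E (range 0 l ++ [ l ])
        ≡⟨ Listₚ.map-++ B.E (range 0 l) [ l ] ⟩
      map B.E (range 0 l) ++ [ B.E l ]
        ≡⟨ ≡.cong₂ (λ xs x → xs ++ [ x ]) (bwd-arc l (ℕₚ.<⇒≤ 1+l≤k)) (B-E l 1+l≤k) ⟩
      reverse (map E (range (k ∸ l) l)) ++ [ E (k ∸ suc l) ]
        ≡⟨ Listₚ.unfold-reverse (E (k ∸ suc l)) (map E (range (k ∸ l) l)) ⟨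
      reverse (E (k ∸ suc l) ∷ map E (range (k ∸ l) l))
        ≡⟨ ≡.cong (λ i → reverse (E (k ∸ suc l) ∷ map E (range i l))) (1+[k∸1+i] 1+l≤k) ⟨
      reverse (map E (range (k ∸ suc l) (suc l)))
        ∎
      where open ≡.≡-Reasoning

    arcLength : ℕ → ℕ → Carrier
    arcLength i l = ℓ (map E (range i l))

    -- length of the r–V j path in the cycle with the edge E p removed
    distance : ℕ → ℕ → Carrier
    distance p j = if j ℕ.≤ᵇ p then arcLength 0 j else arcLength j (k ∸ j)

    distance-≤ : ∀ {p j} → j ℕ.≤ p → distance p j ≡ arcLength 0 j
    distance-≤ {p} {j} j≤p with j ℕ.≤ᵇ p | ℕₚ.≤⇒≤ᵇ j≤p
    ... | true | _ = ≡.refl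

    distance-> : ∀ {p j} → p < j → distance p j ≡ arcLength j (k ∸ j)
    distance-> {p} {j} p<j with j ℕ.≤ᵇ p in eq
    ... | false = ≡.refl
    ... | true  = ⊥-elim (ℕₚ.<⇒≱ p<j (ℕₚ.≤ᵇ⇒≤ j p (≡.subst Bool.T (≡.sym eq) _)))

    L-path≈distance : ∀ p → p < k → ∀ {w} (P : Path (Cycle k) r w) → E p ∉ pedges (Cycle k) P →
                      ∀ j → j < k → w ≡ V j → ℓ (pedges (Cycle k) P) ≈ distance p j
    L-path≈distance p p<k (walk , walk!) Ep∉ j j<k w≡ with root-path-direction walk (≡.sym V-0) walk!
    ... | inj₁ (n , n<k , w≡′ , edges≡) with V-injective n<k j<k (≡.trans (≡.sym w≡′) w≡)
    ...   | ≡.refl with j ℕ.≤? p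
    ...     | yes j≤p = reflexive (≡.trans (≡.cong ℓ edges≡) (≡.sym (distance-≤ j≤p)))
    ...     | no  j≰p = ⊥-elim (Ep∉ (≡.subst (E p ∈_) (≡.sym edges≡) (FP.E∈arc⁺ z≤n (ℕₚ.≰⇒> j≰p))))
    L-path≈distance p p<k (walk , walk!) Ep∉ j j<k w≡ | inj₂ (zero , _ , w≡′ , edges≡)
      with V-injective j<k 0<k (≡.trans (≡.sym w≡) (≡.trans w≡′ (≡.trans (B-V 0 z≤n) V-k)))
    ... | ≡.refl = reflexive (≡.trans (≡.cong ℓ edges≡) (≡.sym (distance-≤ {p} {0} z≤n)))
    L-path≈distance p p<k (walk , walk!) Ep∉ j j<k w≡ | inj₂ (suc n , n<k , w≡′ , edges≡)
      with V-injective j<k (k∸1+i<k (ℕₚ.<⇒≤ n<k)) (≡.trans (≡.sym w≡) (≡.trans w≡′ (B-V (suc n) (ℕₚ.<⇒≤ n<k))))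
    ... | ≡.refl with (k ∸ suc n) ℕ.≤? p
    ...   | yes j≤p = ⊥-elim (Ep∉ (≡.subst (E p ∈_) (≡.sym edges≡′)
                        (Anyₚ.reverse⁺ (FP.E∈arc⁺ j≤p (≡.subst (p <_) (≡.sym (ℕₚ.m∸n+n≡m (ℕₚ.<⇒≤ n<k))) p<k)))))
      where
      edges≡′ : edges (Cycle k) walk ≡ reverse (map E (range (k ∸ suc n) (suc n)))
      edges≡′ = ≡.trans edges≡ (bwd-arc (suc n) (ℕₚ.<⇒≤ n<k))
    ...   | no  j≰p = begin
      ℓ (edges (Cycle k) walk)                             ≡⟨ ≡.cong ℓ (≡.trans edges≡ (bwd-arc (suc n) (ℕₚ.<⇒≤ n<k))) ⟩
      ℓ (reverse (map E (range (k ∸ suc n) (suc n))))      ≈⟨ L-reverse (map E (range (k ∸ suc n) (suc n))) ⟩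
      arcLength (k ∸ suc n) (suc n)                        ≡⟨ ≡.cong (arcLength (k ∸ suc n)) (k∸[k∸1+i]≡1+i (ℕₚ.<⇒≤ n<k)) ⟨
      arcLength (k ∸ suc n) (k ∸ (k ∸ suc n))              ≡⟨ distance-> (ℕₚ.≰⇒> j≰p) ⟨
      distance p (k ∸ suc n)                               ∎
      where open ≈-Reasoning

    vertices : List (Fin k)
    vertices = map V (range 0 k)

    Unique-vertices : Unique vertices
    Unique-vertices = Unique-map⁺-onAll V V-injective (All.tabulate (λ t∈ → proj₂ (∈-range⁻ 0 k t∈))) (Unique-range 0 k)

    ∈-vertices : ∀ w → w ∈ vertices
    ∈-vertices w with V-surjective w
    ... | j , j<k , ≡.refl = ∈-map⁺ V (∈-range⁺ 0 k z≤n j<k)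

    cost-AllBut : ∀ p → p < k → (T : Subset k) → AllBut T (E p) → (paths : ∀ w → TreePath (Cycle k) r T w) →
                  cost (Cycle k) S γ τ r T paths ≈ (sumFin τ - τ (E p)) + sumL (map (distance p) (range 0 k))
    cost-AllBut p p<k T T-E@(Tp , _) paths = +-cong (sumFin-AllBut τ {T} T-E) (begin
      sumFin (λ w → ℓ (pedges (Cycle k) (proj₁ (paths w))))         ≈⟨ sumFin-enumeration _ Unique-vertices ∈-vertices ⟩
      sumL (map (λ w → ℓ (pedges (Cycle k) (proj₁ (paths w)))) vertices)
                                                                     ≡⟨ ≡.cong sumL (Listₚ.map-∘ (range 0 k)) ⟨
      sumL (map (λ j → ℓ (pedges (Cycle k) (proj₁ (paths (V j))))) (range 0 k))
                                                                     ≈⟨ sumL-map-cong (range 0 k) (λ {j} j∈ →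
                                                                          L-path≈distance p p<k (proj₁ (paths (V j)))
                                                                            (false∉All T (proj₂ (paths (V j))) Tp)
                                                                            j (proj₂ (∈-range⁻ 0 k j∈)) ≡.refl) ⟩
      sumL (map (distance p) (range 0 k))                            ∎)
      where open ≈-Reasoning

    arcLength-++ : ∀ i a b → arcLength i (a ℕ.+ b) ≈ arcLength i a + arcLength (i ℕ.+ a) b
    arcLength-++ i a b = begin
      ℓ (map E (range i (a ℕ.+ b)))                       ≡⟨ ≡.cong (λ js → ℓ (map E js)) (range-++ i a b) ⟩
      ℓ (map E (range i a ++ range (i ℕ.+ a) b))          ≡⟨ ≡.cong ℓ (Listₚ.map-++ E (range i a) (range (i ℕ.+ a) b)) ⟩
      ℓ (map E (range i a) ++ map E (range (i ℕ.+ a) b))  ≈⟨ L-++ (map E (range i a)) (map E (range (i ℕ.+ a) b)) ⟩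
      arcLength i a + arcLength (i ℕ.+ a) b               ∎
      where open ≈-Reasoning

    sumL-range-const : ∀ x i n → sumL (map (λ _ → x) (range i n)) ≈ n · x
    sumL-range-const x i n = ≈-trans (sumL-map-const x (range i n)) (reflexive (≡.cong (_· x) (length-range i n)))

    length-arc : ∀ i n → length (map E (range i n)) ≡ n
    length-arc i n = ≡.trans (Listₚ.length-map E (range i n)) (length-range i n)

    C-arc : ∀ i n → c (map E (range i n)) ≈ sumL (map (arcLength i) (range 0 (suc n)))
    C-arc i zero    = ≈-refl
    C-arc i (suc n) = begin
      c (E i ∷ map E (range (suc i) n))
        ≈⟨ C-∷ (E i) (map E (range (suc i) n)) ⟩
      suc (length (map E (range (suc i) n))) · γ (E i) + c (map E (range (suc i) n))
        ≈⟨ +-cong (reflexive (≡.cong (λ l → suc l · γ (E i)) (length-arc (suc i) n))) (C-arc (suc i) n) ⟩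
      suc n · γ (E i) + sumL (map (arcLength (suc i)) (range 0 (suc n)))
        ≈⟨ +-congʳ (sumL-range-const (γ (E i)) 0 (suc n)) ⟨
      sumL (map (λ _ → γ (E i)) (range 0 (suc n))) + sumL (map (arcLength (suc i)) (range 0 (suc n)))
        ≈⟨ sumL-map-+ (λ _ → γ (E i)) (arcLength (suc i)) (range 0 (suc n)) ⟨
      sumL (map (λ t → γ (E i) + arcLength (suc i) t) (range 0 (suc n)))
        ≡⟨ ≡.cong sumL (map-range-suc (arcLength i) 0 (suc n)) ⟨
      sumL (map (arcLength i) (range 1 (suc n)))
        ≈⟨ +-identityˡ _ ⟨
      sumL (map (arcLength i) (range 0 (suc (suc n))))
        ∎
      where open ≈-Reasoning

    -- e₂ = E q and e₁ = E p lie in this order on the fwd arc from r, with the n edges of Q between them.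
    module Exchange (q n : ℕ) (p<k : suc q ℕ.+ n < k) where

      p : ℕ
      p = suc q ℕ.+ n

      Q : List (Fin k)
      Q = map E (range (suc q) n)

      L₂ L₁ : Carrier
      L₂ = arcLength 0 (suc q)
      L₁ = arcLength p (k ∸ p)

      middle : List ℕ
      middle = map (suc q ℕ.+_) (range 0 (suc n))

      above-p : List ℕ
      above-p = range (suc p) (k ∸ suc p)

      range-split : range 0 k ≡ range 0 (suc q) ++ (middle ++ above-p)
      range-split = begin
        range 0 k
          ≡⟨ ≡.cong (range 0) (ℕₚ.m+[n∸m]≡n 1+p≤k) ⟨
        range 0 (suc q ℕ.+ suc n ℕ.+ (k ∸ (suc q ℕ.+ suc n)))
          ≡⟨ ≡.cong (range 0) (ℕₚ.+-assoc (suc q) (suc n) _) ⟩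
        range 0 (suc q ℕ.+ (suc n ℕ.+ (k ∸ (suc q ℕ.+ suc n))))
          ≡⟨ range-++ 0 (suc q) _ ⟩
        range 0 (suc q) ++ range (suc q) (suc n ℕ.+ (k ∸ (suc q ℕ.+ suc n)))
          ≡⟨ ≡.cong (range 0 (suc q) ++_) (range-++ (suc q) (suc n) _) ⟩
        range 0 (suc q) ++ (range (suc q) (suc n) ++ range (suc q ℕ.+ suc n) (k ∸ (suc q ℕ.+ suc n)))
          ≡⟨ ≡.cong₂ (λ xs i → range 0 (suc q) ++ (xs ++ range i (k ∸ i))) middle≡ (ℕₚ.+-suc (suc q) n) ⟩
        range 0 (suc q) ++ (middle ++ above-p)
          ∎
        where
        open ≡.≡-Reasoning
        1+p≤k : suc q ℕ.+ suc n ℕ.≤ k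
        1+p≤k = ≡.subst (ℕ._≤ k) (≡.sym (ℕₚ.+-suc (suc q) n)) p<k
        middle≡ : range (suc q) (suc n) ≡ middle
        middle≡ = ≡.trans (≡.cong (λ i → range i (suc n)) (≡.sym (ℕₚ.+-identityʳ (suc q)))) (range-+ (suc q) 0 (suc n))

      split-range : ∀ f → sumL (map f (range 0 k)) ≈
                    sumL (map f (range 0 (suc q))) + (sumL (map (λ t → f (suc q ℕ.+ t)) (range 0 (suc n))) + sumL (map f above-p))
      split-range f = begin
        sumL (map f (range 0 k))
          ≡⟨ ≡.cong (λ js → sumL (map f js)) range-split ⟩
        sumL (map f (range 0 (suc q) ++ (middle ++ above-p)))
          ≈⟨ sumL-map-++ f (range 0 (suc q)) _ ⟩
        sumL (map f (range 0 (suc q))) + sumL (map f (middle ++ above-p))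
          ≈⟨ +-congˡ (sumL-map-++ f middle above-p) ⟩
        sumL (map f (range 0 (suc q))) + (sumL (map f middle) + sumL (map f above-p))
          ≡⟨ ≡.cong (λ xs → sumL (map f (range 0 (suc q))) + (sumL xs + sumL (map f above-p))) (≡.sym (Listₚ.map-∘ (range 0 (suc n)))) ⟩
        sumL (map f (range 0 (suc q))) + (sumL (map (λ t → f (suc q ℕ.+ t)) (range 0 (suc n))) + sumL (map f above-p))
          ∎
        where open ≈-Reasoning

      below : sumL (map (distance p) (range 0 (suc q))) ≈ sumL (map (distance q) (range 0 (suc q)))
      below = sumL-map-cong (range 0 (suc q)) λ j∈ →
        let j≤q = ℕₚ.≤-pred (proj₂ (∈-range⁻ 0 (suc q) j∈)) in
        reflexive (≡.trans (distance-≤ (ℕₚ.≤-trans j≤q (ℕₚ.m≤n⇒m≤1+n (ℕₚ.m≤m+n q n)))) (≡.sym (distance-≤ j≤q)))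

      above : sumL (map (distance p) above-p) ≈ sumL (map (distance q) above-p)
      above = sumL-map-cong above-p λ j∈ →
        let p<j = proj₁ (∈-range⁻ (suc p) (k ∸ suc p) j∈) in
        reflexive (≡.trans (distance-> p<j) (≡.sym (distance-> (ℕₚ.<-trans (s≤s (ℕₚ.m≤m+n q n)) p<j))))

      middle-p : sumL (map (λ t → distance p (suc q ℕ.+ t)) (range 0 (suc n))) ≈ suc n · L₂ + c Q
      middle-p = begin
        sumL (map (λ t → distance p (suc q ℕ.+ t)) (range 0 (suc n)))
          ≈⟨ sumL-map-cong (range 0 (suc n)) (λ t∈ → distance-p-middle (ℕₚ.≤-pred (proj₂ (∈-range⁻ 0 (suc n) t∈)))) ⟩
        sumL (map (λ t → L₂ + arcLength (suc q) t) (range 0 (suc n)))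
          ≈⟨ sumL-map-+ (λ _ → L₂) (arcLength (suc q)) (range 0 (suc n)) ⟩
        sumL (map (λ _ → L₂) (range 0 (suc n))) + sumL (map (arcLength (suc q)) (range 0 (suc n)))
          ≈⟨ +-cong (sumL-range-const L₂ 0 (suc n)) (≈-sym (C-arc (suc q) n)) ⟩
        suc n · L₂ + c Q
          ∎
        where
        open ≈-Reasoning
        distance-p-middle : ∀ {t} → t ℕ.≤ n → distance p (suc q ℕ.+ t) ≈ L₂ + arcLength (suc q) t
        distance-p-middle {t} t≤n = ≈-trans (reflexive (distance-≤ (ℕₚ.+-monoʳ-≤ (suc q) t≤n))) (arcLength-++ 0 (suc q) t)

      -- the part of Q after its first t edges
      rest : ℕ → Carrier
      rest t = arcLength (suc q ℕ.+ t) (n ∸ t)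

      1+q+t+[n∸t]≡p : ∀ {t} → t ℕ.≤ n → suc q ℕ.+ t ℕ.+ (n ∸ t) ≡ p
      1+q+t+[n∸t]≡p {t} t≤n = ≡.trans (ℕₚ.+-assoc (suc q) t (n ∸ t)) (≡.cong (suc q ℕ.+_) (ℕₚ.m+[n∸m]≡n t≤n))

      k∸[1+q+t] : ∀ {t} → t ℕ.≤ n → k ∸ (suc q ℕ.+ t) ≡ (n ∸ t) ℕ.+ (k ∸ p)
      k∸[1+q+t] {t} t≤n = ℕₚ.+-cancelˡ-≡ (suc q ℕ.+ t) _ _ (begin
        suc q ℕ.+ t ℕ.+ (k ∸ (suc q ℕ.+ t))           ≡⟨ ℕₚ.m+[n∸m]≡n (ℕₚ.≤-trans (ℕₚ.+-monoʳ-≤ (suc q) t≤n) (ℕₚ.<⇒≤ p<k)) ⟩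
        k                                            ≡⟨ ℕₚ.m+[n∸m]≡n (ℕₚ.<⇒≤ p<k) ⟨
        p ℕ.+ (k ∸ p)                                ≡⟨ ≡.cong (ℕ._+ (k ∸ p)) (1+q+t+[n∸t]≡p t≤n) ⟨
        suc q ℕ.+ t ℕ.+ (n ∸ t) ℕ.+ (k ∸ p)           ≡⟨ ℕₚ.+-assoc (suc q ℕ.+ t) (n ∸ t) (k ∸ p) ⟩
        suc q ℕ.+ t ℕ.+ ((n ∸ t) ℕ.+ (k ∸ p))         ∎)
        where open ≡.≡-Reasoning

      distance-q-middle : ∀ {t} → t ℕ.≤ n → distance q (suc q ℕ.+ t) ≈ rest t + L₁
      distance-q-middle {t} t≤n = begin
        distance q (suc q ℕ.+ t)                                   ≡⟨ distance-> (s≤s (ℕₚ.m≤m+n q t)) ⟩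
        arcLength (suc q ℕ.+ t) (k ∸ (suc q ℕ.+ t))                ≡⟨ ≡.cong (arcLength (suc q ℕ.+ t)) (k∸[1+q+t] t≤n) ⟩
        arcLength (suc q ℕ.+ t) ((n ∸ t) ℕ.+ (k ∸ p))              ≈⟨ arcLength-++ (suc q ℕ.+ t) (n ∸ t) (k ∸ p) ⟩
        rest t + arcLength (suc q ℕ.+ t ℕ.+ (n ∸ t)) (k ∸ p)       ≡⟨ ≡.cong (λ i → rest t + arcLength i (k ∸ p))
                                                                           (1+q+t+[n∸t]≡p t≤n) ⟩
        rest t + L₁                                                ∎
        where open ≈-Reasoning

      middle-q : sumL (map (λ t → distance q (suc q ℕ.+ t)) (range 0 (suc n))) ≈ sumL (map rest (range 0 (suc n))) + suc n · L₁
      middle-q = begin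
        sumL (map (λ t → distance q (suc q ℕ.+ t)) (range 0 (suc n)))
                      ≈⟨ sumL-map-cong (range 0 (suc n)) (λ t∈ → distance-q-middle (ℕₚ.≤-pred (proj₂ (∈-range⁻ 0 (suc n) t∈)))) ⟩
        sumL (map (λ t → rest t + L₁) (range 0 (suc n)))
                      ≈⟨ sumL-map-+ rest (λ _ → L₁) (range 0 (suc n)) ⟩
        sumL (map rest (range 0 (suc n))) + sumL (map (λ _ → L₁) (range 0 (suc n)))
                      ≈⟨ +-congˡ (sumL-range-const L₁ 0 (suc n)) ⟩
        sumL (map rest (range 0 (suc n))) + suc n · L₁
                      ∎
        where open ≈-Reasoning

      C-reverse-Q : c (reverse Q) ≈ sumL (map rest (range 0 (suc n)))
      C-reverse-Q = +-cancelˡ (c Q) _ _ (begin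
        c Q + c (reverse Q)                                     ≈⟨ C-reverse Q ⟩
        suc (length Q) · ℓ Q                                    ≡⟨ ≡.cong (λ l → suc l · ℓ Q) (length-arc (suc q) n) ⟩
        suc n · ℓ Q                                             ≈⟨ sumL-range-const (ℓ Q) 0 (suc n) ⟨
        sumL (map (λ _ → ℓ Q) (range 0 (suc n)))                ≈⟨ sumL-map-cong (range 0 (suc n))
                                                                     (λ t∈ → split-Q (ℕₚ.≤-pred (proj₂ (∈-range⁻ 0 (suc n) t∈)))) ⟩
        sumL (map (λ t → arcLength (suc q) t + rest t) (range 0 (suc n)))
                                                                ≈⟨ sumL-map-+ (arcLength (suc q)) rest (range 0 (suc n)) ⟩
        sumL (map (arcLength (suc q)) (range 0 (suc n))) + sumL (map rest (range 0 (suc n)))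
                                                                ≈⟨ +-congʳ (C-arc (suc q) n) ⟨
        c Q + sumL (map rest (range 0 (suc n)))                 ∎)
        where
        open ≈-Reasoning
        split-Q : ∀ {t} → t ℕ.≤ n → ℓ Q ≈ arcLength (suc q) t + rest t
        split-Q {t} t≤n =
          ≈-trans (reflexive (≡.cong (arcLength (suc q)) (≡.sym (ℕₚ.m+[n∸m]≡n t≤n)))) (arcLength-++ (suc q) t (n ∸ t))

      -- Removing e₂ instead of e₁ changes only the distances to the vertices of Q, which are now
      -- reached forward across e₂ (through P₂) instead of backward across e₁ (through P₁).
      distance-exchange : (sumL (map (distance p) (range 0 k)) + c (reverse Q)) + suc n · L₁ ≈
                          (sumL (map (distance q) (range 0 k)) + suc n · L₂) + c Q
      distance-exchange = begin
        (sumL (map (distance p) (range 0 k)) + c (reverse Q)) + suc n · L₁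
          ≈⟨ +-congʳ (+-cong (≈-trans (split-range (distance p)) (+-congˡ (+-cong middle-p above))) C-reverse-Q) ⟩
        (Bp + ((suc n · L₂ + c Q) + A) + R) + suc n · L₁
          ≈⟨ regroup _ _ _ _ _ _ ⟩
        (Bp + ((R + suc n · L₁) + A) + suc n · L₂) + c Q
          ≈⟨ +-congʳ (+-congʳ (+-cong below (+-congʳ (≈-sym middle-q)))) ⟩
        (Bq + (sumL (map (λ t → distance q (suc q ℕ.+ t)) (range 0 (suc n))) + A) + suc n · L₂) + c Q
          ≈⟨ +-congʳ (+-congʳ (≈-sym (split-range (distance q)))) ⟩
        (sumL (map (distance q) (range 0 k)) + suc n · L₂) + c Q
          ∎
        where
        open ≈-Reasoning
        Bp Bq A R : Carrier
        Bp = sumL (map (distance p) (range 0 (suc q)))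
        Bq = sumL (map (distance q) (range 0 (suc q)))
        A = sumL (map (distance q) above-p)
        R = sumL (map rest (range 0 (suc n)))
        regroup : ∀ b l₂ cq a r l₁ → ((b + ((l₂ + cq) + a)) + r) + l₁ ≈ ((b + ((r + l₁) + a)) + l₂) + cq
        regroup = solve 6 (λ b l₂ cq a r l₁ → (((b ⊕ ((l₂ ⊕ cq) ⊕ a)) ⊕ r) ⊕ l₁) ⊜ (((b ⊕ ((r ⊕ l₁) ⊕ a)) ⊕ l₂) ⊕ cq)) ≈-refl
          where open Solver

      distance-exchange-along : ∀ {Q′ l₁ l₂} → Q′ ≡ Q → l₁ ≈ L₁ → l₂ ≡ L₂ →
        (sumL (map (distance p) (range 0 k)) + c (reverse Q′)) + suc (length Q′) · l₁ ≈
        (sumL (map (distance q) (range 0 k)) + suc (length Q′) · l₂) + c Q′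
      distance-exchange-along ≡.refl l₁≈L₁ ≡.refl rewrite length-arc (suc q) n =
        ≈-trans (+-congˡ (·-congʳ (suc n) l₁≈L₁)) distance-exchange

      q<p : q < p
      q<p = s≤s (ℕₚ.m≤m+n q n)

      1+q<k : suc q < k
      1+q<k = ℕₚ.≤-<-trans (ℕₚ.m≤m+n (suc q) n) p<k

      k∸p<k : k ∸ p < k
      k∸p<k = k∸1+i<k (ℕₚ.<-trans (ℕₚ.n<1+n (q ℕ.+ n)) p<k)

      Q-path : Path (Cycle k) (V (suc q)) (V p)
      Q-path = proj₁ (FP.arc (suc q) n p<k) , FP.Unique-arc (suc q) n p<k

      edges-Q : pedges (Cycle k) Q-path ≡ Q
      edges-Q = proj₁ (proj₂ (FP.arc (suc q) n p<k))

      P₂ : Path (Cycle k) r (V (suc q))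
      P₂ = castʷ V-0 ≡.refl (proj₁ (FP.arc 0 (suc q) 1+q<k)) ,
           ≡.subst Unique (≡.sym (verts-castʷ V-0 ≡.refl _)) (FP.Unique-arc 0 (suc q) 1+q<k)

      edges-P₂ : pedges (Cycle k) P₂ ≡ map E (range 0 (suc q))
      edges-P₂ = ≡.trans (edges-castʷ V-0 ≡.refl _) (proj₁ (proj₂ (FP.arc 0 (suc q) 1+q<k)))

      V-p≡ : B.V (k ∸ p) ≡ V p
      V-p≡ = ≡.trans (B-V (k ∸ p) (ℕₚ.m∸n≤m k p)) (≡.cong V (ℕₚ.m∸[m∸n]≡n (ℕₚ.<⇒≤ p<k)))

      P₁ : Path (Cycle k) r (V p)
      P₁ = castʷ B.V-0 V-p≡ (proj₁ (BP.arc 0 (k ∸ p) k∸p<k)) ,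
           ≡.subst Unique (≡.sym (verts-castʷ B.V-0 V-p≡ _)) (BP.Unique-arc 0 (k ∸ p) k∸p<k)

      edges-P₁ : pedges (Cycle k) P₁ ≡ reverse (map E (range p (k ∸ p)))
      edges-P₁ = begin
        pedges (Cycle k) P₁                               ≡⟨ edges-castʷ B.V-0 V-p≡ _ ⟩
        edges (Cycle k) (proj₁ (BP.arc 0 (k ∸ p) k∸p<k))  ≡⟨ proj₁ (proj₂ (BP.arc 0 (k ∸ p) k∸p<k)) ⟩
        map B.E (range 0 (k ∸ p))                         ≡⟨ bwd-arc (k ∸ p) (ℕₚ.m∸n≤m k p) ⟩
        reverse (map E (range (k ∸ (k ∸ p)) (k ∸ p)))     ≡⟨ ≡.cong (λ i → reverse (map E (range i (k ∸ p))))
                                                                    (ℕₚ.m∸[m∸n]≡n (ℕₚ.<⇒≤ p<k)) ⟩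
        reverse (map E (range p (k ∸ p)))                 ∎
        where open ≡.≡-Reasoning

      P₂-ends : EndsWith (Cycle k) (E q) P₂
      P₂-ends = map E (range 0 q) ,
        ≡.trans edges-P₂ (≡.trans (≡.cong (map E) (range-∷ʳ 0 q)) (Listₚ.map-++ E (range 0 q) [ q ]))

      P₁-ends : EndsWith (Cycle k) (E p) P₁
      P₁-ends = reverse (map E (range (suc p) (k ∸ suc p))) ,
        ≡.trans edges-P₁ (≡.trans (≡.cong (λ l → reverse (map E (range p l))) (≡.sym (1+[k∸1+i] p<k)))
                                  (Listₚ.unfold-reverse (E p) (map E (range (suc p) (k ∸ suc p)))))

      Ep∉P₂ : E p ∉ pedges (Cycle k) P₂
      Ep∉P₂ Ep∈ = ℕₚ.<-irrefl ≡.refl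
        (ℕₚ.<-≤-trans (proj₂ (FP.E∈arc⁻ p<k (ℕₚ.<⇒≤ 1+q<k) (≡.subst (E p ∈_) edges-P₂ Ep∈))) (ℕₚ.m≤m+n (suc q) n))

      Eq∉P₁ : E q ∉ pedges (Cycle k) P₁
      Eq∉P₁ Eq∈ = ℕₚ.<-irrefl ≡.refl (ℕₚ.<-≤-trans q<p
                    (proj₁ (FP.E∈arc⁻ (ℕₚ.<-trans q<p p<k) (ℕₚ.≤-reflexive (ℕₚ.m+[n∸m]≡n (ℕₚ.<⇒≤ p<k)))
                              (Anyₚ.reverse⁻ (≡.subst (E q ∈_) edges-P₁ Eq∈)))))

      Ep∉Q : E p ∉ pedges (Cycle k) Q-path
      Ep∉Q Ep∈ = ℕₚ.<-irrefl ≡.refl (proj₂ (FP.E∈arc⁻ p<k (ℕₚ.<⇒≤ p<k) (≡.subst (E p ∈_) edges-Q Ep∈)))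

      Eq∉Q : E q ∉ pedges (Cycle k) Q-path
      Eq∉Q Eq∈ = ℕₚ.<-irrefl ≡.refl (ℕₚ.<-≤-trans (ℕₚ.n<1+n q)
                   (proj₁ (FP.E∈arc⁻ (ℕₚ.<-trans q<p p<k) (ℕₚ.<⇒≤ p<k) (≡.subst (E q ∈_) edges-Q Eq∈))))

      ℓP₁≈L₁ : ℓ (pedges (Cycle k) P₁) ≈ L₁
      ℓP₁≈L₁ = ≈-trans (reflexive (≡.cong ℓ edges-P₁)) (L-reverse (map E (range p (k ∸ p))))

      exchange : ∀ m {v} → ExchangeCondition m (E p) v →
                 (R₁ : Path (Cycle k) r v) → E p ∉ pedges (Cycle k) R₁ → E q ∈ pedges (Cycle k) R₁ →
                 (R₂ : Path (Cycle k) r v) → E q ∉ pedges (Cycle k) R₂ →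
                 (T₁ : Subset k) → AllBut T₁ (E p) → (paths₁ : ∀ w → TreePath (Cycle k) r T₁ w) →
                 (T₂ : Subset k) → AllBut T₂ (E q) → (paths₂ : ∀ w → TreePath (Cycle k) r T₂ w) →
                 (cost (Cycle k) S γ τ r T₁ paths₁ + m · ℓ (pedges (Cycle k) R₁)) ≤
                 (cost (Cycle k) S γ τ r T₂ paths₂ + m · ℓ (pedges (Cycle k) R₂))
      exchange m condition R₁ Ep∉R₁ Eq∈R₁ R₂ Eq∉R₂ T₁ T₁-Ep paths₁ T₂ T₂-Eq paths₂ =
        ≤-from-gap
          (exchange-gap m (length (pedges (Cycle k) Q-path))
             (cost-AllBut p p<k T₁ T₁-Ep paths₁) (cost-AllBut q (ℕₚ.<-trans q<p p<k) T₂ T₂-Eq paths₂)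
             (distance-exchange-along edges-Q ℓP₁≈L₁ (≡.cong ℓ edges-P₂)))
          (condition R₁ Ep∉R₁ (E q) Eq∈R₁ R₂ Eq∉R₂ (V p) P₁ P₁-ends Eq∉P₁ (V (suc q)) P₂ P₂-ends Ep∉P₂
                     Q-path Ep∉Q Eq∉Q)

    exchange-on-arc : ∀ m {v e₁ e₂} → ExchangeCondition m e₁ v →
                      (R₁ : Path (Cycle k) r v) → e₁ ∉ pedges (Cycle k) R₁ → e₂ ∈ pedges (Cycle k) R₁ →
                      ∀ s → s < k → pedges (Cycle k) R₁ ≡ map E (range 0 s) →
                      (R₂ : Path (Cycle k) r v) → e₂ ∉ pedges (Cycle k) R₂ →
                      (T₁ : Subset k) → AllBut T₁ e₁ → (paths₁ : ∀ w → TreePath (Cycle k) r T₁ w) →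
                      (T₂ : Subset k) → AllBut T₂ e₂ → (paths₂ : ∀ w → TreePath (Cycle k) r T₂ w) →
                      (cost (Cycle k) S γ τ r T₁ paths₁ + m · ℓ (pedges (Cycle k) R₁)) ≤
                      (cost (Cycle k) S γ τ r T₂ paths₂ + m · ℓ (pedges (Cycle k) R₂))
    exchange-on-arc m {e₁ = e₁} {e₂} condition R₁ e₁∉R₁ e₂∈R₁ s s<k edges-R₁ R₂ e₂∉R₂ T₁ T₁-e₁ paths₁ T₂ T₂-e₂ paths₂
      with E-surjective e₁ | E-surjective e₂
    ... | p , p<k , ≡.refl | q , q<k , ≡.refl
      with FP.E∈arc⁻ q<k (ℕₚ.<⇒≤ s<k) (≡.subst (E q ∈_) edges-R₁ e₂∈R₁)
    ...   | _ , q<s with ℕₚ.m≤n⇒∃[o]m+o≡n (ℕₚ.<-≤-trans q<s s≤p)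
      where
      s≤p : s ℕ.≤ p
      s≤p = ℕₚ.≮⇒≥ (λ p<s → e₁∉R₁ (≡.subst (E p ∈_) (≡.sym edges-R₁) (FP.E∈arc⁺ z≤n p<s)))
    ...     | n , ≡.refl =
      Exchange.exchange q n p<k m condition R₁ e₁∉R₁ e₂∈R₁ R₂ e₂∉R₂ T₁ T₁-e₁ paths₁ T₂ T₂-e₂ paths₂

  avoiding-paths-same-length : ∀ e {w} (R R′ : Path (Cycle k) r w) →
                               e ∉ pedges (Cycle k) R → e ∉ pedges (Cycle k) R′ →
                               ℓ (pedges (Cycle k) R) ≈ ℓ (pedges (Cycle k) R′)
  avoiding-paths-same-length e {w} R R′ e∉R e∉R′ with E-surjective e | V-surjective w
    where open OppositeOrientations standard
  ... | p , p<k , ≡.refl | j , j<k , w≡ =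
    ≈-trans (L-path≈distance p p<k R e∉R j j<k w≡) (≈-sym (L-path≈distance p p<k R′ e∉R′ j j<k w≡))
    where open Along standard

  cycle-exchange : ∀ {e₁} → IsCableTrench (Cycle k) S γ τ r (∁ ⁅ e₁ ⁆) → ∀ m {v} → ExchangeCondition m e₁ v →
                   (paths₁ : ∀ w → TreePath (Cycle k) r (∁ ⁅ e₁ ⁆) w) (R₁ : TreePath (Cycle k) r (∁ ⁅ e₁ ⁆) v) →
                   (T₂ : Subset k) → IsSpanningTree (Cycle k) r T₂ →
                   (paths₂ : ∀ w → TreePath (Cycle k) r T₂ w) (R₂ : TreePath (Cycle k) r T₂ v) →
                   (cost (Cycle k) S γ τ r (∁ ⁅ e₁ ⁆) paths₁ + m · ℓ (pedges (Cycle k) (proj₁ R₁))) ≤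
                   (cost (Cycle k) S γ τ r T₂ paths₂ + m · ℓ (pedges (Cycle k) (proj₁ R₂)))
  cycle-exchange {e₁} T₁-optimal m condition paths₁ (R₁ , R₁⊆T₁) T₂ T₂-spanning paths₂ (R₂ , R₂⊆T₂)
    with missing-edge {k} T₂ (proj₂ T₂-spanning)
  ... | e₂ , T₂-e₂ with e₂ ∈? pedges (Cycle k) R₁ | false∉All T₂ R₂⊆T₂ (proj₁ T₂-e₂)
  ...   | no e₂∉R₁ | e₂∉R₂ =
    +-mono-≤ (proj₂ T₁-optimal T₂ T₂-spanning paths₁ paths₂)
             (≤-reflexive (·-congʳ m (avoiding-paths-same-length e₂ R₁ R₂ e₂∉R₁ e₂∉R₂)))
  ...   | yes e₂∈R₁ | e₂∉R₂ with root-path-arc R₁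
  ...     | O , s , s<k , edges≡ =
    Along.exchange-on-arc O m condition R₁ (false∉All (∁ ⁅ e₁ ⁆) R₁⊆T₁ (proj₁ (∁⁅e⁆-AllBut e₁))) e₂∈R₁ s s<k edges≡
                          R₂ e₂∉R₂ (∁ ⁅ e₁ ⁆) (∁⁅e⁆-AllBut e₁) paths₁ T₂ T₂-e₂ paths₂

open import Data.Vec using (_++_)

proposition2 :
    (S : OrderedCommRing) → let open OrderedCommRing S in
    (k : ℕ) .{{_ : NonZero k}} → 3 ℕ.≤ k →
    (r : Fin k) (γG τG : Fin k → Carrier) (e₁ : Fin k) →
    IsCableTrench (Cycle k) S γG τG r (∁ ⁅ e₁ ⁆) →
    (m : ℕ) (H : Graph (suc m)) (rH : Fin (suc m))
    (γH τH : Fin (nE H) → Carrier) (TH : Subset (nE H)) →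
    IsCableTrench H S γH τH rH TH →
    (v : Fin k) → v ≢ r →
    (∀ (R₁ : Path (Cycle k) r v) → e₁ ∉ pedges (Cycle k) R₁ →
     ∀ e₂ → e₂ ∈ pedges (Cycle k) R₁ →
     ∀ (R₂ : Path (Cycle k) r v) → e₂ ∉ pedges (Cycle k) R₂ →
     ∀ a (P₁ : Path (Cycle k) r a) → EndsWith (Cycle k) e₁ P₁ → e₂ ∉ pedges (Cycle k) P₁ →
     ∀ b (P₂ : Path (Cycle k) r b) → EndsWith (Cycle k) e₂ P₂ → e₁ ∉ pedges (Cycle k) P₂ →
     ∀ (Q : Path (Cycle k) b a) → e₁ ∉ pedges (Cycle k) Q → e₂ ∉ pedges (Cycle k) Q →
     0# ≥ (τG e₂ - τG e₁
           + (L (Cycle k) S γG (pedges (Cycle k) P₂) - L (Cycle k) S γG (pedges (Cycle k) P₁))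
           + (length (pedges (Cycle k) Q)
               · (L (Cycle k) S γG (pedges (Cycle k) P₂) - L (Cycle k) S γG (pedges (Cycle k) P₁)))
           + C (Cycle k) S γG (pedges (Cycle k) Q)
           - C (Cycle k) S γG (reverse (pedges (Cycle k) Q))
           + (m · (L (Cycle k) S γG (pedges (Cycle k) R₁) - L (Cycle k) S γG (pedges (Cycle k) R₂))))) →
    IsCableTrench (wedge (Cycle k) v H rH) S (joinW γG γH) (joinW τG τH) (r ↑ˡ m) (∁ ⁅ e₁ ⁆ ++ TH)
proposition2 S k k≥3 r γG τG e₁ T₁-optimal m H rH γH τH TH TH-optimal v _ condition = T-spanning , T-optimal
  where
  open OrderedCommRingProperties S
  open WedgeStructure (Cycle k) v H rH using (W)
  open WedgeTrees S (Cycle k) v r H rH γG τG γH τH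
  open CycleCosts k k≥3 r S γG τG using (cycle-exchange; avoiding-paths-same-length)

  k∸1+m≡k+m∸1 : k ℕ.∸ 1 ℕ.+ m ≡ k ℕ.+ m ℕ.∸ 1
  k∸1+m≡k+m∸1 = ≡.sym (ℕₚ.+-∸-comm m (ℕₚ.<-≤-trans (ℕ.s≤s ℕ.z≤n) k≥3))

  T-spanning : IsSpanningTree W root (∁ ⁅ e₁ ⁆ ++ TH)
  T-spanning = Lift.paths (∁ ⁅ e₁ ⁆) TH (proj₁ (proj₁ T₁-optimal)) (proj₁ (proj₁ TH-optimal)) ,
               ≡.trans (∣++∣ (∁ ⁅ e₁ ⁆) TH)
                       (≡.trans (≡.cong₂ ℕ._+_ (proj₂ (proj₁ T₁-optimal)) (proj₂ (proj₁ TH-optimal))) k∸1+m≡k+m∸1)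

  T-optimal : ∀ T′ → IsSpanningTree W root T′ → ∀ paths paths′ →
              cost W S (joinW γG γH) (joinW τG τH) root (∁ ⁅ e₁ ⁆ ++ TH) paths ≤
              cost W S (joinW γG γH) (joinW τG τH) root T′ paths′
  T-optimal T′ (_ , ∣T′∣≡) paths paths′ with Vec.splitAt k T′
  ... | UG , UH , T′≡ =
    ≤-respˡ-≈ (≈-sym (A.cost-split uniform₁)) (≤-respʳ-≈ (≈-sym (B.cost-split uniform₂))
      (+-mono-≤ (cycle-exchange T₁-optimal m condition A.pathsG (A.pathsG v) UG UG-spanning B.pathsG (B.pathsG v))
                (proj₂ TH-optimal UH UH-spanning A.pathsH B.pathsH)))
    where
    module A = Restrict (∁ ⁅ e₁ ⁆ ++ TH) (∁ ⁅ e₁ ⁆) TH ≡.refl paths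
    module B = Restrict T′ UG UH T′≡ paths′
    tight : ∣ UG ∣ ≡ k ℕ.∸ 1 × ∣ UH ∣ ≡ m
    tight = ≤-+-tight (spanning⇒∣T∣≥n∸1 (Cycle k) r UG B.pathsG) (spanning⇒∣T∣≥n∸1 H rH UH B.pathsH)
              (≡.trans (≡.sym (∣++∣ UG UH)) (≡.trans (≡.cong ∣_∣ (≡.sym T′≡)) (≡.trans ∣T′∣≡ (≡.sym k∸1+m≡k+m∸1))))
    UG-spanning : IsSpanningTree (Cycle k) r UG
    UG-spanning = B.pathsG , proj₁ tight
    UH-spanning : IsSpanningTree H rH UH
    UH-spanning = B.pathsH , proj₂ tight
    uniform₁ : ∀ R R′ → LG (pedges (Cycle k) (proj₁ R)) ≈ LG (pedges (Cycle k) (proj₁ R′))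
    uniform₁ (R , R⊆) (R′ , R′⊆) =
      avoiding-paths-same-length e₁ R R′ (false∉All (∁ ⁅ e₁ ⁆) R⊆ e₁∉) (false∉All (∁ ⁅ e₁ ⁆) R′⊆ e₁∉)
      where
      e₁∉ : lookup (∁ ⁅ e₁ ⁆) e₁ ≡ false
      e₁∉ = proj₁ (∁⁅e⁆-AllBut e₁)
    uniform₂ : ∀ R R′ → LG (pedges (Cycle k) (proj₁ R)) ≈ LG (pedges (Cycle k) (proj₁ R′))
    uniform₂ (R , R⊆) (R′ , R′⊆) with missing-edge {k} UG (proj₁ tight)
    ... | e₂ , UG-e₂ = avoiding-paths-same-length e₂ R R′ (false∉All UG R⊆ (proj₁ UG-e₂)) (false∉All UG R′⊆ (proj₁ UG-e₂))
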